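{- Let $S$ be a set of finite strings, no one a substring of another, let $c$ be a small cycle of $\mathcal{C}(S)$ (i.e. $o(c)>2w(c)$), and let $s,t$ be strings of $c$ such that $(s,t)$ is not an edge of $c$. Then there is a shortest superstring of $S$ in which $s$ and $t$ are not merged, i.e. there is an ordering $u_1,\dots,u_m$ of $S$ such that the string $\mathrm{pref}(u_1,u_2)\cdots\mathrm{pref}(u_{m-1},u_m)u_m$ is a shortest superstring of $S$ and there is no index $i$ with $u_i=s$ and $u_{i+1}=t$.
   Context: For strings $s\neq t$, $\mathrm{ov}(s,t)$ is the longest suffix of $s$ that is a prefix of $t$; $\mathrm{ov}(s,s)$ is the longest suffix of $s$ of length less than $|s|$ that is also a prefix of $s$; $s=\mathrm{pref}(s,t)\mathrm{ov}(s,t)$ and $\mathrm{dist}(s,t)=|\mathrm{pref}(s,t)|$. A superstring of $S$ corresponds to an ordering $u_1,\dots,u_m$ of $S$ via $\mathrm{pref}(u_1,u_2)\cdots\mathrm{pref}(u_{m-1},u_m)u_m$ (a shortest superstring can always be written this way); strings $s,t$ are merged in it if $s$ immediately precedes $t$. $\mathcal{C}(S)$ is the cycle cover computed by MGREEDY (fixed tie-breaking): sort all ordered pairs $(s,t)$ of $S$ (including $s=t$) by non-increasing $|\mathrm{ov}(s,t)|$, scan and add $(s,t)$ iff no previously added edge has tail $s$ or head $t$. For a cycle $c$: $w(c)$ is the sum of $\mathrm{dist}$ over its edges, and $o(c)$ is $|\mathrm{ov}|$ of its cycle-closing edge (the last edge of $c$ added by MGREEDY). -}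

module Defs where

open import Data.Bool using (Bool; true; false; if_then_else_)
open import Data.Nat using (ℕ; zero; suc; _+_; _*_; _∸_; _≤_; _<_)
open import Data.List using (List; []; _∷_; _++_; [_]; length; take; drop; map; zip; filter; last; cartesianProduct)
open import Data.List.Properties using (≡-dec)
open import Data.Nat.ListAction using (sum)
open import Data.List.Membership.Propositional using (_∈_)
open import Data.List.Relation.Unary.Any using (any?)
open import Data.List.Relation.Unary.Unique.Propositional using (Unique)
open import Data.List.Relation.Unary.Linked using (Linked)
open import Data.List.Relation.Binary.Permutation.Propositional using (_↭_)
open import Data.Maybe using (Maybe; just; nothing; maybe)
open import Data.Product using (_×_; _,_; proj₁; proj₂; ∃; ∃-syntax; Σ)
open import Data.Product.Properties using () renaming (≡-dec to ×-≡-dec)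
open import Relation.Nullary using (¬_; does)
open import Relation.Binary.Definitions using (DecidableEquality)
open import Relation.Binary.PropositionalEquality using (_≡_; _≢_)

Str : Set → Set
Str A = List A

Edge : Set → Set
Edge A = Str A × Str A

module _ {A : Set} (_≟_ : DecidableEquality A) where

  _≟s_ : DecidableEquality (Str A)
  _≟s_ = ≡-dec _≟_

  _≟e_ : DecidableEquality (Edge A)
  _≟e_ = ×-≡-dec _≟s_ _≟s_

  -- Does the suffix of s of length k equal the prefix of t of length k?
  -- (For k ≤ |s| this forces k ≤ |t|, by comparing lengths.)
  sufPre : Str A → Str A → ℕ → Bool
  sufPre s t k = does (drop (length s ∸ k) s ≟s take k t)

  searchOv : Str A → Str A → ℕ → ℕ
  searchOv s t zero    = zero
  searchOv s t (suc b) = if sufPre s t (suc b) then suc b else searchOv s t b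

  -- |ov(s,t)|: longest suffix of s that is a prefix of t;
  -- for s = t it must be shorter than s.
  ovLen : Str A → Str A → ℕ
  ovLen s t = searchOv s t (if does (s ≟s t) then length s ∸ 1 else length s)

  ov : Str A → Str A → Str A
  ov s t = drop (length s ∸ ovLen s t) s

  pref : Str A → Str A → Str A
  pref s t = take (length s ∸ ovLen s t) s

  dist : Str A → Str A → ℕ
  dist s t = length (pref s t)

  mergeAll : List (Str A) → Str A
  mergeAll []           = []
  mergeAll (u ∷ [])     = u
  mergeAll (u ∷ v ∷ us) = pref u v ++ mergeAll (v ∷ us)

  -- The input is the list of all ordered pairs (s,t) of S
  -- (including s = t) already sorted by non-increasing |ov| with an
  -- arbitrary fixed tie-breaking; the output lists the chosen edges in
  -- the order in which they were added.

  hasTail : Str A → List (Edge A) → Bool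
  hasTail s es = does (any? (λ e → proj₁ e ≟s s) es)

  hasHead : Str A → List (Edge A) → Bool
  hasHead t es = does (any? (λ e → proj₂ e ≟s t) es)

  mgreedyAux : List (Edge A) → List (Edge A) → List (Edge A)
  mgreedyAux added []             = added
  mgreedyAux added ((s , t) ∷ ps) =
    if hasTail s added then mgreedyAux added ps
    else if hasHead t added then mgreedyAux added ps
    else mgreedyAux (added ++ [ (s , t) ]) ps

  mgreedy : List (Edge A) → List (Edge A)
  mgreedy = mgreedyAux []

  -- Cycles.  A cycle v₀ → v₁ → ⋯ → v_{k-1} → v₀ is given by the list of
  -- its (distinct) vertices; its edges are (vᵢ , v_{i+1 mod k}).

  cycleEdges : List (Str A) → List (Edge A)
  cycleEdges []       = []
  cycleEdges (v ∷ vs) = zip (v ∷ vs) (vs ++ [ v ])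

  IsCycleOf : List (Edge A) → List (Str A) → Set
  IsCycleOf C c = (c ≢ []) × Unique c × (∀ {e} → e ∈ cycleEdges c → e ∈ C)

  weight : List (Str A) → ℕ
  weight c = sum (map (λ e → dist (proj₁ e) (proj₂ e)) (cycleEdges c))

  -- o(c): |ov| of the cycle-closing edge of c, i.e. the edge of c that
  -- appears last in the MGREEDY output list G.
  closingOv : List (Edge A) → List (Str A) → ℕ
  closingOv G c =
    maybe (λ e → ovLen (proj₁ e) (proj₂ e)) zero
          (last (filter (λ e → any? (λ f → e ≟e f) (cycleEdges c)) G))

  IsSubstring : Str A → Str A → Set
  IsSubstring u x = ∃[ p ] ∃[ q ] (p ++ u ++ q ≡ x)

  IsSuperstring : List (Str A) → Str A → Set
  IsSuperstring S x = ∀ {s} → s ∈ S → IsSubstring s x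

  IsShortestSuperstring : List (Str A) → Str A → Set
  IsShortestSuperstring S x =
    IsSuperstring S x × (∀ y → IsSuperstring S y → length x ≤ length y)

  SubstringFree : List (Str A) → Set
  SubstringFree S = ∀ {s t} → s ∈ S → t ∈ S → s ≢ t → ¬ IsSubstring s t

  Merged : Str A → Str A → List (Str A) → Set
  Merged s t u = ∃[ p ] ∃[ q ] (u ≡ p ++ s ∷ t ∷ q)

  SortedPairs : List (Str A) → List (Edge A) → Set
  SortedPairs S L =
    (L ↭ cartesianProduct S S) ×
    Linked (λ e f → ovLen (proj₁ f) (proj₂ f) ≤ ovLen (proj₁ e) (proj₂ e)) L

-- A shortest superstring is the merge of a cost-minimal ordering: sorting a substring-free set by
-- first occurrence in any superstring y gives an ordering whose merge is no longer than y.
--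
-- Let v₀ → ⋯ → v_{k-1} be a small cycle, d_n = dist(v_n, v_{n+1}) and w = Σ d_n. Every cycle edge
-- overlaps by at least o(c) > 2w, so all v_n are factors of a single word of period w, with v_n
-- starting at offset d₀ + ⋯ + d_{n-1}. If dist(v_n, v_{n+r}) < d_n + ⋯ + d_{n+r-1} for some
-- 0 < r < k, that word would have a period e < w, and some v_i would overlap the head of the closing
-- edge more than it overlaps v_{i+1}. MGREEDY scans pairs by non-increasing overlap, so it would
-- have reached that pair before (v_i, v_{i+1}), and could only have skipped it because the closing
-- edge was already chosen -- but the closing edge is the last cycle edge to be chosen. Hence
-- dist(s, v) + dist(v, t) ≤ dist(s, t) for the cycle successor v of s, and moving v between s and t
-- in an optimal ordering that merges them keeps it optimal.

module Submission where

open import Defs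
open import Data.Bool using (true; false; if_then_else_)
open import Data.Empty using (⊥; ⊥-elim)
open import Data.Maybe using (Maybe; just; nothing; maybe)
open import Data.Nat
open import Data.Nat.Properties
open import Algebra.Properties.CommutativeSemigroup +-commutativeSemigroup using (xy∙z≈xz∙y)
open import Data.Nat.DivMod
open import Data.Nat.ListAction using (sum)
open import Data.List using (List; []; _∷_; _++_; [_]; length; take; drop; map; concatMap; filter; last; zip; applyUpTo)
open import Data.List.Membership.Propositional using (_∈_; _∉_; find)
open import Data.List.Membership.Propositional.Properties
  using (∈-map⁺; ∈-map⁻; ∈-∃++; ∈-concat⁺′; ∈-concat⁻′; ∈-++⁺ˡ; ∈-++⁺ʳ; ∈-++⁻; ∈-filter⁺; ∈-filter⁻; ∈-applyUpTo⁺; ∈-applyUpTo⁻; ∈-cartesianProduct⁺; ∈-cartesianProduct⁻)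
open import Data.List.Relation.Unary.Any using (here; there; any?)
open import Data.List.Relation.Unary.All as All using (All; []; _∷_)
open import Data.List.Relation.Unary.All.Properties using (¬Any⇒All¬) renaming (++⁺ to All-++⁺)
open import Data.List.Relation.Unary.Linked using (Linked; _∷_)
open import Data.List.Relation.Unary.Linked.Properties using (Linked⇒AllPairs)
open import Data.List.Extrema.Nat using (argmin; argmin-all; f[argmin]≤f[xs])
import Data.List.Sort as Sort
import Relation.Binary.Construct.On as On
open import Data.List.Relation.Unary.AllPairs as AllPairs using (AllPairs; []; _∷_)
open import Data.List.Relation.Unary.Unique.Propositional using (Unique)
open import Data.List.Relation.Unary.Unique.Propositional.Properties using (Unique[x∷xs]⇒x∉xs)
open import Data.List.Relation.Binary.Permutation.Propositional using (_↭_; prep; swap; ↭-refl; ↭-sym; ↭-trans; ↭⇒↭ₛ)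
import Data.List.Relation.Binary.Permutation.Setoid.Properties as PermutationSetoid
open import Data.List.Relation.Binary.Permutation.Propositional.Properties using (∈-resp-↭; ↭-empty-inv; shift; drop-mid)
open import Data.List.Properties using (map-applyUpTo; ∷-injectiveˡ; ∷-injectiveʳ; length-++; ++-assoc; ++-identityʳ; length-take; length-drop; filter-++; take++drop≡id; drop-drop; drop-all)
open import Data.Sum using (_⊎_; inj₁; inj₂; [_,_]′)
open import Data.Product using (_×_; _,_; proj₁; proj₂; ∃-syntax)
open import Function using (_on_)
open import Relation.Nullary using (¬_; Dec; yes; no; does)
open import Relation.Unary using (Decidable)
open import Relation.Binary.Definitions using (DecidableEquality)
open import Relation.Binary.PropositionalEquality
  using (_≡_; _≢_; refl; sym; trans; cong; cong₂; subst; subst₂; setoid; module ≡-Reasoning)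

module _ {X : Set} where

  _!?_ : List X → ℕ → Maybe X
  []       !? _     = nothing
  (x ∷ xs) !? zero  = just x
  (x ∷ xs) !? suc m = xs !? m

  drop-!? : ∀ n (xs : List X) m → drop n xs !? m ≡ xs !? (n + m)
  drop-!? zero    xs       m = refl
  drop-!? (suc n) []       m = refl
  drop-!? (suc n) (x ∷ xs) m = drop-!? n xs m

  take-!? : ∀ n (xs : List X) {m} → m < n → take n xs !? m ≡ xs !? m
  take-!? (suc n) []       _         = refl
  take-!? (suc n) (x ∷ xs) {zero}  _ = refl
  take-!? (suc n) (x ∷ xs) {suc m} (s≤s m<n) = take-!? n xs m<n

  ≡-by-!? : ∀ (xs ys : List X) → length xs ≡ length ys →
            (∀ m → m < length xs → xs !? m ≡ ys !? m) → xs ≡ ys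
  ≡-by-!? []       []       _  _ = refl
  ≡-by-!? (x ∷ xs) (y ∷ ys) eq agree with agree 0 z<s
  ... | refl = cong (x ∷_) (≡-by-!? xs ys (suc-injective eq) (λ m m< → agree (suc m) (s≤s m<)))

  length-take≡ : ∀ {n} (xs : List X) → n ≤ length xs → length (take n xs) ≡ n
  length-take≡ {n} xs n≤ = trans (length-take n xs) (m≤n⇒m⊓n≡m n≤)

  drop-length-++ : ∀ (xs ys : List X) → drop (length xs) (xs ++ ys) ≡ ys
  drop-length-++ []       ys = refl
  drop-length-++ (x ∷ xs) ys = drop-length-++ xs ys

  take-length-++ : ∀ (xs ys : List X) → take (length xs) (xs ++ ys) ≡ xs
  take-length-++ []       ys = refl
  take-length-++ (x ∷ xs) ys = cong (x ∷_) (take-length-++ xs ys)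

  length-take≤ : ∀ n (xs : List X) → length (take n xs) ≤ length xs
  length-take≤ n xs = ≤-trans (≤-reflexive (length-take n xs)) (m⊓n≤n n (length xs))

  Unique-resp-↭ : ∀ {xs ys : List X} → xs ↭ ys → Unique xs → Unique ys
  Unique-resp-↭ p = PermutationSetoid.Unique-resp-↭ (setoid X) (↭⇒↭ₛ p)

  Unique-shift : ∀ (P : List X) x Q → Unique (P ++ x ∷ Q) → Unique (x ∷ P ++ Q)
  Unique-shift P x Q = Unique-resp-↭ (shift x P Q)

  Unique-∷-suffix : ∀ (xs : List X) {x ys xs′ ys′} → Unique (xs ++ x ∷ ys) →
                    xs ++ x ∷ ys ≡ xs′ ++ x ∷ ys′ → ys ≡ ys′
  Unique-∷-suffix []       {xs′ = []}      _          eq = ∷-injectiveʳ eq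
  Unique-∷-suffix []       {xs′ = _ ∷ xs′} (x∉ ∷ _)   eq =
    ⊥-elim (All.lookup x∉ (subst (_ ∈_) (sym (∷-injectiveʳ eq)) (∈-++⁺ʳ xs′ (here refl))) refl)
  Unique-∷-suffix (y ∷ xs) {xs′ = []}      (y∉ ∷ _)   eq =
    ⊥-elim (All.lookup y∉ (subst (λ z → z ∈ xs ++ _ ∷ _) (sym (∷-injectiveˡ eq)) (∈-++⁺ʳ xs (here refl))) refl)
  Unique-∷-suffix (y ∷ xs) {xs′ = _ ∷ xs′} (_ ∷ uniq) eq = Unique-∷-suffix xs uniq (∷-injectiveʳ eq)

  insertions : X → List X → List (List X)
  insertions x []       = [ [ x ] ]
  insertions x (y ∷ ys) = (x ∷ y ∷ ys) ∷ map (y ∷_) (insertions x ys)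

  permutations : List X → List (List X)
  permutations []       = [ [] ]
  permutations (x ∷ xs) = concatMap (insertions x) (permutations xs)

  ∈-insertions : ∀ x P Q → P ++ x ∷ Q ∈ insertions x (P ++ Q)
  ∈-insertions x []      []      = here refl
  ∈-insertions x []      (_ ∷ _) = here refl
  ∈-insertions x (p ∷ P) Q       = there (∈-map⁺ (p ∷_) (∈-insertions x P Q))

  insertions-↭ : ∀ x ys {zs} → zs ∈ insertions x ys → zs ↭ x ∷ ys
  insertions-↭ x []       (here refl) = ↭-refl
  insertions-↭ x (y ∷ ys) (here refl) = ↭-refl
  insertions-↭ x (y ∷ ys) (there zs∈) with ∈-map⁻ (y ∷_) zs∈
  ... | _ , zs′∈ , refl = ↭-trans (prep y (insertions-↭ x ys zs′∈)) (swap y x ↭-refl)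

  permutations-↭ : ∀ xs {u} → u ∈ permutations xs → u ↭ xs
  permutations-↭ []       (here refl) = ↭-refl
  permutations-↭ (x ∷ xs) u∈ with ∈-concat⁻′ (map (insertions x) (permutations xs)) u∈
  ... | ys , u∈ys , ys∈ with ∈-map⁻ (insertions x) ys∈
  ...   | v , v∈ , refl = ↭-trans (insertions-↭ x v u∈ys) (prep x (permutations-↭ xs v∈))

  ∈-permutations : ∀ xs {u} → u ↭ xs → u ∈ permutations xs
  ∈-permutations []       u↭ rewrite ↭-empty-inv u↭ = here refl
  ∈-permutations (x ∷ xs) u↭ with ∈-∃++ (∈-resp-↭ (↭-sym u↭) (here refl))
  ... | P , Q , refl = ∈-concat⁺′ (∈-insertions x P Q)
                         (∈-map⁺ (insertions x) (∈-permutations xs (drop-mid P [] u↭)))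

  AllPairs-∷ʳ : ∀ {R : X → X → Set} {xs y} → AllPairs R xs → All (λ x → R x y) xs →
                AllPairs R (xs ++ [ y ])
  AllPairs-∷ʳ {xs = []}     []            []           = [] ∷ []
  AllPairs-∷ʳ {xs = _ ∷ _} (Rx ∷ pairs) (Rxy ∷ Rxsy) = All-++⁺ Rx (Rxy ∷ []) ∷ AllPairs-∷ʳ pairs Rxsy

  AllPairs-≢-injective : ∀ {K : Set} (key : X → K) {xs} → AllPairs (λ a b → key a ≢ key b) xs →
                         ∀ {a b} → a ∈ xs → b ∈ xs → key a ≡ key b → a ≡ b
  AllPairs-≢-injective key (_ ∷ _)    (here refl) (here refl) _  = refl
  AllPairs-≢-injective key (ka≢ ∷ _)  (here refl) (there b∈) eq = ⊥-elim (All.lookup ka≢ b∈ eq)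
  AllPairs-≢-injective key (kb≢ ∷ _)  (there a∈) (here refl) eq = ⊥-elim (All.lookup kb≢ a∈ (sym eq))
  AllPairs-≢-injective key (_ ∷ rest) (there a∈) (there b∈) eq = AllPairs-≢-injective key rest a∈ b∈ eq

  Before : List X → X → X → Set
  Before xs a b = ∃[ P ] ∃[ Q ] ∃[ R ] (xs ≡ P ++ a ∷ Q ++ b ∷ R)

  Before-∈ : ∀ {xs a b} → Before xs a b → a ∈ xs
  Before-∈ (P , _ , _ , refl) = ∈-++⁺ʳ P (here refl)

  Before-++ : ∀ {xs ys a b} → a ∈ xs → b ∈ ys → Before (xs ++ ys) a b
  Before-++ a∈ b∈ with ∈-∃++ a∈ | ∈-∃++ b∈
  ... | P , Q , refl | Q′ , R , refl = P , Q ++ Q′ , R , (begin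
    (P ++ _ ∷ Q) ++ Q′ ++ _ ∷ R ≡⟨ ++-assoc P _ _ ⟩
    P ++ _ ∷ Q ++ Q′ ++ _ ∷ R   ≡⟨ cong (λ W → P ++ _ ∷ W) (++-assoc Q Q′ _) ⟨
    P ++ _ ∷ (Q ++ Q′) ++ _ ∷ R ∎)
    where open ≡-Reasoning

  Before-total : ∀ {xs a b} → a ∈ xs → b ∈ xs → a ≢ b → Before xs a b ⊎ Before xs b a
  Before-total a∈ b∈ a≢b with ∈-∃++ a∈
  ... | P , W , refl with ∈-++⁻ P b∈
  ...   | inj₁ b∈P         = inj₂ (Before-++ b∈P (here refl))
  ...   | inj₂ (here b≡a)  = ⊥-elim (a≢b (sym b≡a))
  ...   | inj₂ (there b∈W) with ∈-∃++ b∈W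
  ...     | Q , R , refl = inj₁ (P , Q , R , refl)

  AllPairs-Before : ∀ {R : X → X → Set} {xs a b} → AllPairs R xs → Before xs a b → R a b
  AllPairs-Before {R} {a = a} {b} pairs (P , Q , Rest , refl) = go P pairs
    where
    go : ∀ P → AllPairs R (P ++ a ∷ Q ++ b ∷ Rest) → R a b
    go []      (Ra ∷ _)   = All.lookup Ra (∈-++⁺ʳ Q (here refl))
    go (_ ∷ P) (_ ∷ rest) = go P rest

  last-∈ : ∀ xs {z : X} → last xs ≡ just z → z ∈ xs
  last-∈ (x ∷ [])     refl = here refl
  last-∈ (x ∷ y ∷ xs) eq   = there (last-∈ (y ∷ xs) eq)

  last-∷-just : ∀ (x : X) xs → ∃[ z ] (last (x ∷ xs) ≡ just z)
  last-∷-just x []       = x , refl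
  last-∷-just x (y ∷ xs) = last-∷-just y xs

  last-++-∷ : ∀ (xs : List X) y ys → last (xs ++ y ∷ ys) ≡ last (y ∷ ys)
  last-++-∷ []           y ys = refl
  last-++-∷ (x ∷ [])     y ys = refl
  last-++-∷ (x ∷ x′ ∷ xs) y ys = last-++-∷ (x′ ∷ xs) y ys

  module _ {P : X → Set} (P? : Decidable P) where

    last-filter-∈ : ∀ xs {z} → last (filter P? xs) ≡ just z → z ∈ xs × P z
    last-filter-∈ xs eq = ∈-filter⁻ P? (last-∈ (filter P? xs) eq)

    last-filter-just : ∀ {xs x} → x ∈ xs → P x → ∃[ z ] (last (filter P? xs) ≡ just z)
    last-filter-just x∈ Px with ∈-∃++ (∈-filter⁺ P? x∈ Px)
    ... | F , F′ , eq with last-∷-just _ F′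
    ...   | z , last≡ = z , trans (cong last eq) (trans (last-++-∷ F _ F′) last≡)

    last-filter-suffix : ∀ xs ys {y z} → y ∈ ys → P y → last (filter P? (xs ++ ys)) ≡ just z → z ∈ ys
    last-filter-suffix xs ys y∈ Py eq with ∈-∃++ (∈-filter⁺ P? y∈ Py)
    ... | F , F′ , ys-eq = proj₁ (last-filter-∈ ys (begin
      last (filter P? ys)                        ≡⟨ cong last ys-eq ⟩
      last (F ++ _ ∷ F′)                         ≡⟨ last-++-∷ F _ F′ ⟩
      last (_ ∷ F′)                              ≡⟨ last-++-∷ (filter P? xs ++ F) _ F′ ⟨
      last ((filter P? xs ++ F) ++ _ ∷ F′)       ≡⟨ cong last (++-assoc (filter P? xs) F _) ⟩
      last (filter P? xs ++ F ++ _ ∷ F′)         ≡⟨ cong (λ W → last (filter P? xs ++ W)) ys-eq ⟨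
      last (filter P? xs ++ filter P? ys)        ≡⟨ cong last (filter-++ P? xs ys) ⟨
      last (filter P? (xs ++ ys))                ≡⟨ eq ⟩
      just _                                     ∎))
      where open ≡-Reasoning

    last-filter-¬Before : ∀ {xs z b} → Unique xs → last (filter P? xs) ≡ just z → P b → ¬ Before xs z b
    last-filter-¬Before unique eq Pb (Q , Q′ , R , refl) =
      Unique[x∷xs]⇒x∉xs (Unique-shift Q _ (Q′ ++ _ ∷ R) unique)
        (∈-++⁺ʳ Q (last-filter-suffix (Q ++ [ _ ]) (Q′ ++ _ ∷ R) (∈-++⁺ʳ Q′ (here refl)) Pb
          (trans (cong (λ W → last (filter P? W)) (++-assoc Q [ _ ] _)) eq)))

  applyUpTo-cong< : ∀ {f g : ℕ → X} {n} → (∀ {i} → i < n → f i ≡ g i) → applyUpTo f n ≡ applyUpTo g n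
  applyUpTo-cong< {n = zero}  f≗g = refl
  applyUpTo-cong< {n = suc n} f≗g = cong₂ _∷_ (f≗g z<s) (applyUpTo-cong< (λ i<n → f≗g (s≤s i<n)))

  nth : X → List X → ℕ → X
  nth d []       _       = d
  nth d (x ∷ xs) zero    = x
  nth d (x ∷ xs) (suc i) = nth d xs i

  nth-++ˡ : ∀ d xs ys {i} → i < length xs → nth d (xs ++ ys) i ≡ nth d xs i
  nth-++ˡ d (x ∷ xs) ys {zero}  _         = refl
  nth-++ˡ d (x ∷ xs) ys {suc i} (s≤s i<) = nth-++ˡ d xs ys i<

  nth-++-length : ∀ d xs y ys → nth d (xs ++ y ∷ ys) (length xs) ≡ y
  nth-++-length d []       y ys = refl
  nth-++-length d (x ∷ xs) y ys = nth-++-length d xs y ys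

  nth-∈ : ∀ d xs {i} → i < length xs → nth d xs i ∈ xs
  nth-∈ d (x ∷ xs) {zero}  _        = here refl
  nth-∈ d (x ∷ xs) {suc i} (s≤s i<) = there (nth-∈ d xs i<)

  ∈⇒nth : ∀ d xs {x} → x ∈ xs → ∃[ i ] (i < length xs × nth d xs i ≡ x)
  ∈⇒nth d (y ∷ xs) (here refl) = 0 , z<s , refl
  ∈⇒nth d (y ∷ xs) (there x∈) with ∈⇒nth d xs x∈
  ... | i , i< , eq = suc i , s≤s i< , eq

  nth-injective : ∀ d xs → Unique xs → ∀ {i j} → i < length xs → j < length xs →
                  nth d xs i ≡ nth d xs j → i ≡ j
  nth-injective d (x ∷ xs) _          {zero}  {zero}  _        _        _  = refl
  nth-injective d (x ∷ xs) (x∉ ∷ _)   {zero}  {suc j} _        (s≤s j<) eq =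
    ⊥-elim (All.lookup x∉ (nth-∈ d xs j<) eq)
  nth-injective d (x ∷ xs) (x∉ ∷ _)   {suc i} {zero}  (s≤s i<) _        eq =
    ⊥-elim (All.lookup x∉ (nth-∈ d xs i<) (sym eq))
  nth-injective d (x ∷ xs) (_ ∷ uniq) {suc i} {suc j} (s≤s i<) (s≤s j<) eq =
    cong suc (nth-injective d xs uniq i< j< eq)

  zip≡applyUpTo-nth : ∀ d (xs ys : List X) → length xs ≡ length ys →
                      zip xs ys ≡ applyUpTo (λ i → nth d xs i , nth d ys i) (length xs)
  zip≡applyUpTo-nth d []       []       _  = refl
  zip≡applyUpTo-nth d (x ∷ xs) (y ∷ ys) eq = cong ((x , y) ∷_) (zip≡applyUpTo-nth d xs ys (suc-injective eq))

-- Cycles as periodic sequences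

≡-mod⇒≡⊎+≤ : ∀ k .{{_ : NonZero k}} {a b} → a ≤ b → a % k ≡ b % k → a ≡ b ⊎ a + k ≤ b
≡-mod⇒≡⊎+≤ k {a} {b} a≤b a≡b with m≤n⇒m<n∨m≡n (/-monoˡ-≤ k a≤b)
... | inj₂ a/k≡b/k = inj₁ (begin-equality
  a                   ≡⟨ m≡m%n+[m/n]*n a k ⟩
  a % k + (a / k) * k ≡⟨ cong₂ (λ r q → r + q * k) a≡b a/k≡b/k ⟩
  b % k + (b / k) * k ≡⟨ m≡m%n+[m/n]*n b k ⟨
  b                   ∎)
  where open ≤-Reasoning
... | inj₁ a/k<b/k = inj₂ (begin
  a + k                     ≡⟨ cong (_+ k) (m≡m%n+[m/n]*n a k) ⟩
  a % k + (a / k) * k + k   ≡⟨ +-assoc (a % k) _ k ⟩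
  a % k + ((a / k) * k + k) ≡⟨ cong (a % k +_) (+-comm ((a / k) * k) k) ⟩
  a % k + suc (a / k) * k   ≤⟨ +-mono-≤ (≤-reflexive a≡b) (*-monoˡ-≤ k a/k<b/k) ⟩
  b % k + (b / k) * k       ≡⟨ m≡m%n+[m/n]*n b k ⟨
  b                         ∎)
  where open ≤-Reasoning

module Cycle {X : Set} (v₀ : X) (vs : List X) where

  k : ℕ
  k = suc (length vs)

  vertex : ℕ → X
  vertex n = nth v₀ (v₀ ∷ vs) (n % k)

  vertex-+k : ∀ n → vertex (n + k) ≡ vertex n
  vertex-+k n = cong (nth v₀ (v₀ ∷ vs)) ([m+n]%n≡m%n n k)

  vertex-% : ∀ n → vertex (n % k) ≡ vertex n
  vertex-% n = cong (nth v₀ (v₀ ∷ vs)) (m%n%n≡m%n n k)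

  vertex-< : ∀ {i} → i < k → vertex i ≡ nth v₀ (v₀ ∷ vs) i
  vertex-< i<k = cong (nth v₀ (v₀ ∷ vs)) (m<n⇒m%n≡m i<k)

  vertex-suc-% : ∀ n → vertex (suc (n % k)) ≡ vertex (suc n)
  vertex-suc-% n = cong (nth v₀ (v₀ ∷ vs)) (begin-equality
    suc (n % k) % k              ≡⟨ [m+kn]%n≡m%n (suc (n % k)) (n / k) k ⟨
    (suc (n % k) + n / k * k) % k ≡⟨ cong (_% k) (cong suc (m≡m%n+[m/n]*n n k)) ⟨
    suc n % k                    ∎)
    where open ≤-Reasoning

  successor-< : ∀ {i} → i < k → nth v₀ (vs ++ [ v₀ ]) i ≡ vertex (suc i)
  successor-< {i} (s≤s i≤vs) with m≤n⇒m<n∨m≡n i≤vs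
  ... | inj₁ i<vs = trans (nth-++ˡ v₀ vs [ v₀ ] i<vs) (sym (vertex-< (s≤s i<vs)))
  ... | inj₂ refl = trans (nth-++-length v₀ vs v₀ []) (sym (cong (nth v₀ (v₀ ∷ vs)) (n%n≡0 k)))

  cycleEdges≡ : zip (v₀ ∷ vs) (vs ++ [ v₀ ]) ≡ applyUpTo (λ i → vertex i , vertex (suc i)) k
  cycleEdges≡ = trans
    (zip≡applyUpTo-nth v₀ (v₀ ∷ vs) (vs ++ [ v₀ ]) (sym (trans (length-++ vs) (+-comm (length vs) 1))))
    (applyUpTo-cong< λ i<k → cong₂ _,_ (sym (vertex-< i<k)) (successor-< i<k))

  edge-∈ : ∀ n → (vertex n , vertex (suc n)) ∈ zip (v₀ ∷ vs) (vs ++ [ v₀ ])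
  edge-∈ n = subst ((vertex n , vertex (suc n)) ∈_) (sym cycleEdges≡)
    (subst (_∈ applyUpTo (λ i → vertex i , vertex (suc i)) k) (cong₂ _,_ (vertex-% n) (vertex-suc-% n))
      (∈-applyUpTo⁺ (λ i → vertex i , vertex (suc i)) (m%n<n n k)))

  ∈-edge : ∀ {e} → e ∈ zip (v₀ ∷ vs) (vs ++ [ v₀ ]) → ∃[ i ] (e ≡ (vertex i , vertex (suc i)))
  ∈-edge {e} e∈ with ∈-applyUpTo⁻ (λ i → vertex i , vertex (suc i)) (subst (e ∈_) cycleEdges≡ e∈)
  ... | i , _ , eq = i , eq

  ∈⇒vertex : ∀ {x} → x ∈ v₀ ∷ vs → ∃[ i ] (i < k × vertex i ≡ x)
  ∈⇒vertex x∈ with ∈⇒nth v₀ (v₀ ∷ vs) x∈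
  ... | i , i<k , eq = i , i<k , trans (vertex-< i<k) eq

  forward : ∀ {i j} → i < k → j < k → ∃[ r ] (r < k × vertex (i + r) ≡ vertex j)
  forward {i} {j} i<k j<k with i ≤? j
  ... | yes i≤j = j ∸ i , ≤-<-trans (m∸n≤m j i) j<k , cong vertex (m+[n∸m]≡n i≤j)
  ... | no  i≰j = j + k ∸ i , r<k , trans (cong vertex (m+[n∸m]≡n i≤j+k)) (vertex-+k j)
    where
    i≤j+k : i ≤ j + k
    i≤j+k = ≤-trans (<⇒≤ i<k) (m≤n+m k j)
    r<k : j + k ∸ i < k
    r<k = subst (j + k ∸ i <_) (m+n∸m≡n j k) (∸-monoʳ-< (≰⇒> i≰j) i≤j+k)

  module _ (unique : Unique (v₀ ∷ vs)) where

    vertex-injective-% : ∀ {a b} → vertex a ≡ vertex b → a % k ≡ b % k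
    vertex-injective-% {a} {b} = nth-injective v₀ (v₀ ∷ vs) unique (m%n<n a k) (m%n<n b k)

    vertex-distinct : ∀ {a b} → a < b → b < a + k → vertex a ≢ vertex b
    vertex-distinct {a} {b} a<b b<a+k eq with ≡-mod⇒≡⊎+≤ k (<⇒≤ a<b) (vertex-injective-% {a} {b} eq)
    ... | inj₁ refl = <-irrefl refl a<b
    ... | inj₂ a+k≤b = <-irrefl refl (<-≤-trans b<a+k a+k≤b)

module _ {A : Set} (_≟_ : DecidableEquality A) where

  private
    ovl dst : Str A → Str A → ℕ
    ovl = ovLen _≟_
    dst = dist _≟_

  -- Overlaps and distances

  IsOverlap : Str A → Str A → ℕ → Set
  IsOverlap s t k = drop (length s ∸ k) s ≡ take k t

  searchOv-overlap : ∀ s t b → IsOverlap s t (searchOv _≟_ s t b)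
  searchOv-overlap s t zero = drop-all (length s) s ≤-refl
  searchOv-overlap s t (suc b) with _≟s_ _≟_ (drop (length s ∸ suc b) s) (take (suc b) t)
  ... | yes suc-b-overlaps = suc-b-overlaps
  ... | no  _              = searchOv-overlap s t b

  searchOv≤ : ∀ s t b → searchOv _≟_ s t b ≤ b
  searchOv≤ s t zero = z≤n
  searchOv≤ s t (suc b) with sufPre _≟_ s t (suc b)
  ... | true  = ≤-refl
  ... | false = m≤n⇒m≤1+n (searchOv≤ s t b)

  searchOv-maximal : ∀ s t b {k} → k ≤ b → IsOverlap s t k → k ≤ searchOv _≟_ s t b
  searchOv-maximal s t zero    z≤n _ = z≤n
  searchOv-maximal s t (suc b) {k} k≤ k-overlaps
    with _≟s_ _≟_ (drop (length s ∸ suc b) s) (take (suc b) t)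
  ... | yes _ = k≤
  ... | no ¬suc-b-overlaps with m≤n⇒m<n∨m≡n k≤
  ...   | inj₁ (s≤s k≤b) = searchOv-maximal s t b k≤b k-overlaps
  ...   | inj₂ refl      = ⊥-elim (¬suc-b-overlaps k-overlaps)

  private
    ovBound : Str A → Str A → ℕ
    ovBound s t = if does (_≟s_ _≟_ s t) then length s ∸ 1 else length s

    ovBound≤length : ∀ s t → ovBound s t ≤ length s
    ovBound≤length s t with _≟s_ _≟_ s t
    ... | yes _ = m∸n≤m (length s) 1
    ... | no  _ = ≤-refl

  ovLen-overlap : ∀ s t → IsOverlap s t (ovl s t)
  ovLen-overlap s t = searchOv-overlap s t (ovBound s t)

  ovLen≤length : ∀ s t → ovl s t ≤ length s
  ovLen≤length s t = ≤-trans (searchOv≤ s t (ovBound s t)) (ovBound≤length s t)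

  ovLen-self≤ : ∀ s → ovl s s ≤ length s ∸ 1
  ovLen-self≤ s with _≟s_ _≟_ s s
  ... | yes _  = searchOv≤ s s (length s ∸ 1)
  ... | no s≢s = ⊥-elim (s≢s refl)

  ovLen-maximal : ∀ s t {k} → k ≤ length s → (s ≡ t → k ≤ length s ∸ 1) →
                  IsOverlap s t k → k ≤ ovl s t
  ovLen-maximal s t k≤s k≤s∸1 k-overlaps with _≟s_ _≟_ s t
  ... | yes s≡t = searchOv-maximal s t (length s ∸ 1) (k≤s∸1 s≡t) k-overlaps
  ... | no  _   = searchOv-maximal s t (length s) k≤s k-overlaps

  overlap≤lengthʳ : ∀ s t {k} → k ≤ length s → IsOverlap s t k → k ≤ length t
  overlap≤lengthʳ s t {k} k≤s k-overlaps = begin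
    k                              ≡⟨ m∸[m∸n]≡n k≤s ⟨
    length s ∸ (length s ∸ k)      ≡⟨ length-drop (length s ∸ k) s ⟨
    length (drop (length s ∸ k) s) ≡⟨ cong length k-overlaps ⟩
    length (take k t)              ≤⟨ length-take≤ k t ⟩
    length t                       ∎
    where open ≤-Reasoning

  ovLen≤lengthʳ : ∀ s t → ovl s t ≤ length t
  ovLen≤lengthʳ s t = overlap≤lengthʳ s t (ovLen≤length s t) (ovLen-overlap s t)

  dist≡length∸ovLen : ∀ s t → dst s t ≡ length s ∸ ovl s t
  dist≡length∸ovLen s t = length-take≡ s (m∸n≤m (length s) (ovl s t))

  dist≤length : ∀ s t → dst s t ≤ length s
  dist≤length s t = length-take≤ (length s ∸ ovl s t) s

  dist+ovLen≡length : ∀ s t → dst s t + ovl s t ≡ length s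
  dist+ovLen≡length s t =
    trans (cong (_+ ovl s t) (dist≡length∸ovLen s t)) (m∸n+n≡m (ovLen≤length s t))

  length≤dist+length : ∀ s t → length s ≤ dst s t + length t
  length≤dist+length s t = begin
    length s            ≡⟨ dist+ovLen≡length s t ⟨
    dst s t + ovl s t   ≤⟨ +-monoʳ-≤ (dst s t) (ovLen≤lengthʳ s t) ⟩
    dst s t + length t  ∎
    where open ≤-Reasoning

  dist<⇒ovLen> : ∀ s t u → dst s t < dst s u → ovl s u < ovl s t
  dist<⇒ovLen> s t u dt<du with ovl s u <? ovl s t
  ... | yes ov< = ov<
  ... | no  ov≮ = ⊥-elim (<⇒≱ dt<du (subst₂ _≤_ (sym (dist≡length∸ovLen s u)) (sym (dist≡length∸ovLen s t))
                                      (∸-monoʳ-≤ (length s) (≮⇒≥ ov≮))))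

  ovLen-!? : ∀ s t m → m < ovl s t → s !? (dst s t + m) ≡ t !? m
  ovLen-!? s t m m<ov = begin
    s !? (dst s t + m)                       ≡⟨ cong (λ i → s !? (i + m)) (dist≡length∸ovLen s t) ⟩
    s !? (length s ∸ ovl s t + m)            ≡⟨ drop-!? (length s ∸ ovl s t) s m ⟨
    drop (length s ∸ ovl s t) s !? m         ≡⟨ cong (_!? m) (ovLen-overlap s t) ⟩
    take (ovl s t) t !? m                    ≡⟨ take-!? (ovl s t) t m<ov ⟩
    t !? m                                   ∎
    where open ≡-Reasoning

  shift⇒overlap : ∀ s t δ → δ ≤ length s → length s ∸ δ ≤ length t →
                  (∀ m → δ + m < length s → s !? (δ + m) ≡ t !? m) →
                  IsOverlap s t (length s ∸ δ)
  shift⇒overlap s t δ δ≤s k≤t agree = ≡-by-!? _ _ same-length pointwise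
    where
    k : ℕ
    k = length s ∸ δ
    length-suffix : length (drop (length s ∸ k) s) ≡ k
    length-suffix = trans (length-drop (length s ∸ k) s) (m∸[m∸n]≡n (m∸n≤m (length s) δ))
    same-length : length (drop (length s ∸ k) s) ≡ length (take k t)
    same-length = trans length-suffix (sym (length-take≡ t k≤t))
    pointwise : ∀ m → m < length (drop (length s ∸ k) s) →
                drop (length s ∸ k) s !? m ≡ take k t !? m
    pointwise m m<suffix = begin
      drop (length s ∸ k) s !? m ≡⟨ drop-!? (length s ∸ k) s m ⟩
      s !? (length s ∸ k + m)    ≡⟨ cong (λ i → s !? (i + m)) (m∸[m∸n]≡n δ≤s) ⟩
      s !? (δ + m)               ≡⟨ agree m δ+m<s ⟩
      t !? m                     ≡⟨ take-!? k t m<k ⟨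
      take k t !? m              ∎
      where
      open ≡-Reasoning
      m<k : m < k
      m<k = subst (m <_) length-suffix m<suffix
      δ+m<s : δ + m < length s
      δ+m<s = subst (δ + m <_) (m+[n∸m]≡n δ≤s) (+-monoʳ-< δ m<k)

  dist≤shift : ∀ s t δ → (s ≡ t → 1 ≤ δ) → length s ∸ δ ≤ length t →
               (∀ m → δ + m < length s → s !? (δ + m) ≡ t !? m) → dst s t ≤ δ
  dist≤shift s t δ δ-pos k≤t agree with length s ≤? δ
  ... | yes s≤δ = ≤-trans (dist≤length s t) s≤δ
  ... | no  s≰δ = begin
    dst s t                   ≡⟨ dist≡length∸ovLen s t ⟩
    length s ∸ ovl s t        ≤⟨ ∸-monoʳ-≤ (length s) k≤ov ⟩
    length s ∸ (length s ∸ δ) ≡⟨ m∸[m∸n]≡n δ≤s ⟩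
    δ                         ∎
    where
    open ≤-Reasoning
    δ≤s : δ ≤ length s
    δ≤s = <⇒≤ (≰⇒> s≰δ)
    k≤ov : length s ∸ δ ≤ ovl s t
    k≤ov = ovLen-maximal s t (m∸n≤m (length s) δ) (λ s≡t → ∸-monoʳ-≤ (length s) (δ-pos s≡t))
             (shift⇒overlap s t δ δ≤s k≤t agree)

  dist-triangle : ∀ x v y → x ≢ y → dst x y ≤ dst x v + dst v y
  dist-triangle x v y x≢y = dist≤shift x y (d₁ + d₂) (λ x≡y → ⊥-elim (x≢y x≡y)) short agree
    where
    d₁ d₂ : ℕ
    d₁ = dst x v
    d₂ = dst v y
    x∸d₁≡ov : length x ∸ d₁ ≡ ovl x v
    x∸d₁≡ov = trans (cong (length x ∸_) (dist≡length∸ovLen x v)) (m∸[m∸n]≡n (ovLen≤length x v))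
    v∸d₂≡ov : length v ∸ d₂ ≡ ovl v y
    v∸d₂≡ov = trans (cong (length v ∸_) (dist≡length∸ovLen v y)) (m∸[m∸n]≡n (ovLen≤length v y))
    short : length x ∸ (d₁ + d₂) ≤ length y
    short = begin
      length x ∸ (d₁ + d₂) ≡⟨ ∸-+-assoc (length x) d₁ d₂ ⟨
      length x ∸ d₁ ∸ d₂   ≡⟨ cong (_∸ d₂) x∸d₁≡ov ⟩
      ovl x v ∸ d₂         ≤⟨ ∸-monoˡ-≤ d₂ (ovLen≤lengthʳ x v) ⟩
      length v ∸ d₂        ≡⟨ v∸d₂≡ov ⟩
      ovl v y              ≤⟨ ovLen≤lengthʳ v y ⟩
      length y             ∎
      where open ≤-Reasoning
    agree : ∀ m → d₁ + d₂ + m < length x → x !? (d₁ + d₂ + m) ≡ y !? m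
    agree m lt = begin
      x !? (d₁ + d₂ + m)   ≡⟨ cong (x !?_) (+-assoc d₁ d₂ m) ⟩
      x !? (d₁ + (d₂ + m)) ≡⟨ ovLen-!? x v (d₂ + m) in-xv ⟩
      v !? (d₂ + m)        ≡⟨ ovLen-!? v y m in-vy ⟩
      y !? m               ∎
      where
      open ≡-Reasoning
      in-xv : d₂ + m < ovl x v
      in-xv = subst (d₂ + m <_) x∸d₁≡ov
                (subst (_< length x ∸ d₁) (m+n∸m≡n d₁ (d₂ + m))
                  (∸-monoˡ-< (subst (_< length x) (+-assoc d₁ d₂ m) lt) (m≤m+n d₁ (d₂ + m))))
      in-vy : m < ovl v y
      in-vy = subst (m <_) v∸d₂≡ov
                (subst (_< length v ∸ d₂) (m+n∸m≡n d₂ m)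
                  (∸-monoˡ-< (<-≤-trans in-xv (ovLen≤lengthʳ x v)) (m≤m+n d₂ m)))

  ovLen<length : ∀ s t → 1 ≤ length s → (s ≢ t → ¬ IsSubstring _≟_ s t) → ovl s t < length s
  ovLen<length s t 1≤s s⊄t with ovl s t <? length s
  ... | yes ov<s = ov<s
  ... | no  ov≮s = ⊥-elim (full-overlap-impossible (_≟s_ _≟_ s t))
    where
    ov≡s : ovl s t ≡ length s
    ov≡s = ≤-antisym (ovLen≤length s t) (≮⇒≥ ov≮s)
    s≡take : s ≡ take (length s) t
    s≡take = trans (cong (λ i → drop i s) (sym (n∸n≡0 (length s))))
                   (subst (IsOverlap s t) ov≡s (ovLen-overlap s t))
    s-prefix : s ++ drop (length s) t ≡ t
    s-prefix = trans (cong (_++ drop (length s) t) s≡take) (take++drop≡id (length s) t)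
    full-overlap-impossible : Dec (s ≡ t) → ⊥
    full-overlap-impossible (no s≢t)  = s⊄t s≢t ([] , drop (length s) t , s-prefix)
    full-overlap-impossible (yes s≡t) = <⇒≱ (∸-monoʳ-< z<s 1≤s) (begin
      length s      ≡⟨ ov≡s ⟨
      ovl s t       ≡⟨ cong (ovl s) s≡t ⟨
      ovl s s       ≤⟨ ovLen-self≤ s ⟩
      length s ∸ 1  ∎)
      where open ≤-Reasoning

  dist-positive : ∀ s t → 1 ≤ length s → (s ≢ t → ¬ IsSubstring _≟_ s t) → 1 ≤ dst s t
  dist-positive s t 1≤s s⊄t =
    subst (1 ≤_) (sym (dist≡length∸ovLen s t)) (m<n⇒0<n∸m (ovLen<length s t 1≤s s⊄t))

  substring-at : ∀ x h δ → δ + length h ≤ length x →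
                 (∀ m → m < length h → x !? (δ + m) ≡ h !? m) → IsSubstring _≟_ h x
  substring-at x h δ fits agree = take δ x , drop (δ + length h) x , x≡
    where
    h≤rest : length h ≤ length (drop δ x)
    h≤rest = subst (length h ≤_) (sym (length-drop δ x))
               (subst (_≤ length x ∸ δ) (m+n∸m≡n δ (length h)) (∸-monoˡ-≤ δ fits))
    length-window : length (take (length h) (drop δ x)) ≡ length h
    length-window = length-take≡ (drop δ x) h≤rest
    window : take (length h) (drop δ x) ≡ h
    window = ≡-by-!? _ _ length-window λ m m<window →
      let m<h = subst (m <_) length-window m<window in
      trans (take-!? (length h) (drop δ x) m<h) (trans (drop-!? δ x m) (agree m m<h))
    x≡ : take δ x ++ h ++ drop (δ + length h) x ≡ x
    x≡ = begin
      take δ x ++ h ++ drop (δ + length h) x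
        ≡⟨ cong (λ w → take δ x ++ w ++ drop (δ + length h) x) window ⟨
      take δ x ++ take (length h) (drop δ x) ++ drop (δ + length h) x
        ≡⟨ cong (λ w → take δ x ++ take (length h) (drop δ x) ++ w) (drop-drop δ (length h) x) ⟨
      take δ x ++ take (length h) (drop δ x) ++ drop (length h) (drop δ x)
        ≡⟨ cong (take δ x ++_) (take++drop≡id (length h) (drop δ x)) ⟩
      take δ x ++ drop δ x
        ≡⟨ take++drop≡id δ x ⟩
      x ∎
      where open ≡-Reasoning

  dist≤agreeing-shift : ∀ x h δ → (x ≡ h → 1 ≤ δ) → (x ≢ h → ¬ IsSubstring _≟_ h x) →
                        (∀ m → δ + m < length x → m < length h → x !? (δ + m) ≡ h !? m) → dst x h ≤ δ
  dist≤agreeing-shift x h δ δ-pos h⊄x agree with δ + length h ≤? length x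
  ... | yes fits = ⊥-elim (contained (_≟s_ _≟_ x h))
    where
    contained : Dec (x ≡ h) → ⊥
    contained (yes x≡h) = <⇒≱ (+-monoˡ-< (length h) (δ-pos x≡h)) (subst (δ + length h ≤_) (cong length x≡h) fits)
    contained (no x≢h)  = h⊄x x≢h (substring-at x h δ fits λ m m<h →
                            agree m (<-≤-trans (+-monoʳ-< δ m<h) fits) m<h)
  ... | no ¬fits = dist≤shift x h δ δ-pos short λ m in-x →
                     agree m in-x (+-cancelˡ-< δ m (length h) (<-trans in-x x<δ+h))
    where
    x<δ+h : length x < δ + length h
    x<δ+h = ≰⇒> ¬fits
    short : length x ∸ δ ≤ length h
    short = subst (length x ∸ δ ≤_) (m+n∸m≡n δ (length h)) (∸-monoˡ-≤ δ (<⇒≤ x<δ+h))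

  -- Orderings and superstrings

  cost : List (Str A) → ℕ
  cost []           = 0
  cost (u ∷ [])     = length u
  cost (u ∷ v ∷ us) = dst u v + cost (v ∷ us)

  length-mergeAll : ∀ u → length (mergeAll _≟_ u) ≡ cost u
  length-mergeAll []           = refl
  length-mergeAll (u ∷ [])     = refl
  length-mergeAll (u ∷ v ∷ us) =
    trans (length-++ (pref _≟_ u v)) (cong (dst u v +_) (length-mergeAll (v ∷ us)))

  pref++≡++drop : ∀ v w → pref _≟_ v w ++ w ≡ v ++ drop (ovl v w) w
  pref++≡++drop v w = begin
    pref _≟_ v w ++ w                                  ≡⟨ cong (pref _≟_ v w ++_) (take++drop≡id (ovl v w) w) ⟨
    pref _≟_ v w ++ take (ovl v w) w ++ drop (ovl v w) w ≡⟨ cong (λ o → pref _≟_ v w ++ o ++ drop (ovl v w) w) (ovLen-overlap v w) ⟨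
    pref _≟_ v w ++ ov _≟_ v w ++ drop (ovl v w) w     ≡⟨ ++-assoc (pref _≟_ v w) _ _ ⟨
    (pref _≟_ v w ++ ov _≟_ v w) ++ drop (ovl v w) w   ≡⟨ cong (_++ drop (ovl v w) w) (take++drop≡id (length v ∸ ovl v w) v) ⟩
    v ++ drop (ovl v w) w                              ∎
    where open ≡-Reasoning

  mergeAll-prefix : ∀ v us → ∃[ q ] (v ++ q ≡ mergeAll _≟_ (v ∷ us))
  mergeAll-prefix v []       = [] , ++-identityʳ v
  mergeAll-prefix v (w ∷ us) with mergeAll-prefix w us
  ... | q , w++q≡ = drop (ovl v w) w ++ q , (begin
    v ++ drop (ovl v w) w ++ q   ≡⟨ ++-assoc v _ q ⟨
    (v ++ drop (ovl v w) w) ++ q ≡⟨ cong (_++ q) (pref++≡++drop v w) ⟨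
    (pref _≟_ v w ++ w) ++ q     ≡⟨ ++-assoc (pref _≟_ v w) w q ⟩
    pref _≟_ v w ++ w ++ q       ≡⟨ cong (pref _≟_ v w ++_) w++q≡ ⟩
    mergeAll _≟_ (v ∷ w ∷ us)    ∎)
    where open ≡-Reasoning

  mergeAll-superstring : ∀ u → IsSuperstring _≟_ u (mergeAll _≟_ u)
  mergeAll-superstring (v ∷ us) (here refl) with mergeAll-prefix v us
  ... | q , v++q≡ = [] , q , v++q≡
  mergeAll-superstring (v ∷ w ∷ us) (there x∈) with mergeAll-superstring (w ∷ us) x∈
  ... | p , q , eq = pref _≟_ v w ++ p , q ,
                     trans (++-assoc (pref _≟_ v w) p _) (cong (pref _≟_ v w ++_) eq)

  cost-remove : ∀ X v Y → Unique (X ++ v ∷ Y) → cost (X ++ Y) ≤ cost (X ++ v ∷ Y)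
  cost-remove []           v []      _ = z≤n
  cost-remove []           v (y ∷ Y) _ = m≤n+m (cost (y ∷ Y)) (dst v y)
  cost-remove (x ∷ [])     v []      _ = length≤dist+length x v
  cost-remove (x ∷ [])     v (y ∷ Y) ((_ ∷ x≢y ∷ _) ∷ _) = begin
    dst x y + cost (y ∷ Y)             ≤⟨ +-monoˡ-≤ (cost (y ∷ Y)) (dist-triangle x v y x≢y) ⟩
    (dst x v + dst v y) + cost (y ∷ Y) ≡⟨ +-assoc (dst x v) _ _ ⟩
    dst x v + (dst v y + cost (y ∷ Y)) ∎
    where open ≤-Reasoning
  cost-remove (x ∷ x′ ∷ X) v Y (_ ∷ unique) = +-monoʳ-≤ (dst x x′) (cost-remove (x′ ∷ X) v Y unique)

  cost-insert : ∀ P s v t Q → dst s v + dst v t ≤ dst s t →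
                cost (P ++ s ∷ v ∷ t ∷ Q) ≤ cost (P ++ s ∷ t ∷ Q)
  cost-insert []           s v t Q detour = begin
    dst s v + (dst v t + cost (t ∷ Q)) ≡⟨ +-assoc (dst s v) _ _ ⟨
    (dst s v + dst v t) + cost (t ∷ Q) ≤⟨ +-monoˡ-≤ (cost (t ∷ Q)) detour ⟩
    dst s t + cost (t ∷ Q)             ∎
    where open ≤-Reasoning
  cost-insert (p ∷ [])     s v t Q detour = +-monoʳ-≤ (dst p s) (cost-insert [] s v t Q detour)
  cost-insert (p ∷ p′ ∷ P) s v t Q detour = +-monoʳ-≤ (dst p p′) (cost-insert (p′ ∷ P) s v t Q detour)

  Occurs : Str A → Str A → ℕ → Set
  Occurs y x n = take (length x) (drop n y) ≡ x × n + length x ≤ length y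

  occurs? : ∀ y x n → Dec (Occurs y x n)
  occurs? y x n with _≟s_ _≟_ (take (length x) (drop n y)) x | n + length x ≤? length y
  ... | yes window | yes fits = yes (window , fits)
  ... | no ¬window | _        = no λ occ → ¬window (proj₁ occ)
  ... | yes _      | no ¬fits = no λ occ → ¬fits (proj₂ occ)

  occurs-!? : ∀ y x n → Occurs y x n → ∀ m → m < length x → y !? (n + m) ≡ x !? m
  occurs-!? y x n (window , _) m m<x = begin
    y !? (n + m)                     ≡⟨ drop-!? n y m ⟨
    drop n y !? m                    ≡⟨ take-!? (length x) (drop n y) m<x ⟨
    take (length x) (drop n y) !? m  ≡⟨ cong (_!? m) window ⟩
    x !? m                           ∎
    where open ≡-Reasoning

  searchOcc : Str A → Str A → ℕ → ℕ → ℕ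
  searchOcc y x n zero    = n
  searchOcc y x n (suc b) = if does (occurs? y x n) then n else searchOcc y x (suc n) b

  searchOcc-occurs : ∀ y x b n {p} → n ≤ p → p ≤ n + b → Occurs y x p →
                     Occurs y x (searchOcc y x n b)
  searchOcc-occurs y x zero n {p} n≤p p≤n occ =
    subst (Occurs y x) (≤-antisym (subst (p ≤_) (+-identityʳ n) p≤n) n≤p) occ
  searchOcc-occurs y x (suc b) n {p} n≤p p≤n+b occ with occurs? y x n
  ... | yes occ-n = occ-n
  ... | no ¬occ-n with m≤n⇒m<n∨m≡n n≤p
  ...   | inj₁ n<p = searchOcc-occurs y x b (suc n) n<p (subst (p ≤_) (+-suc n b) p≤n+b) occ
  ...   | inj₂ refl = ⊥-elim (¬occ-n occ)

  position : Str A → Str A → ℕ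
  position y x = searchOcc y x 0 (length y)

  substring⇒occurs : ∀ x y → IsSubstring _≟_ x y → Occurs y x (position y x)
  substring⇒occurs x y (p , q , refl) =
    searchOcc-occurs y x (length y) 0 z≤n (≤-trans (m≤m+n (length p) (length x)) fits) occ
    where
    fits : length p + length x ≤ length (p ++ x ++ q)
    fits = begin
      length p + length x              ≤⟨ +-monoʳ-≤ (length p) (m≤m+n (length x) (length q)) ⟩
      length p + (length x + length q) ≡⟨ cong (length p +_) (length-++ x) ⟨
      length p + length (x ++ q)       ≡⟨ length-++ p ⟨
      length (p ++ x ++ q)             ∎
      where open ≤-Reasoning
    occ : Occurs (p ++ x ++ q) x (length p)
    occ = trans (cong (take (length x)) (drop-length-++ p (x ++ q))) (take-length-++ x q) , fits

  occurrences-agree : ∀ y x h {px ph} → Occurs y x px → Occurs y h ph → px ≤ ph →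
                      ∀ m → ph ∸ px + m < length x → m < length h →
                      x !? (ph ∸ px + m) ≡ h !? m
  occurrences-agree y x h {px} {ph} occ-x occ-h px≤ph m in-x in-h = begin
    x !? (ph ∸ px + m)        ≡⟨ occurs-!? y x px occ-x (ph ∸ px + m) in-x ⟨
    y !? (px + (ph ∸ px + m)) ≡⟨ cong (y !?_) (+-assoc px (ph ∸ px) m) ⟨
    y !? (px + (ph ∸ px) + m) ≡⟨ cong (λ i → y !? (i + m)) (m+[n∸m]≡n px≤ph) ⟩
    y !? (ph + m)             ≡⟨ occurs-!? y h ph occ-h m in-h ⟩
    h !? m                    ∎
    where open ≡-Reasoning

  dist≤gap : ∀ y x h {px ph} → x ≢ h → ¬ IsSubstring _≟_ h x →
             Occurs y x px → Occurs y h ph → px ≤ ph → dst x h ≤ ph ∸ px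
  dist≤gap y x h x≢h h⊄x occ-x occ-h px≤ph =
    dist≤agreeing-shift x h _ (λ x≡h → ⊥-elim (x≢h x≡h)) (λ _ → h⊄x) (occurrences-agree y x h occ-x occ-h px≤ph)

  ByPosition : Str A → Str A → Str A → Set
  ByPosition y a b = position y a ≤ position y b

  cost-byPosition : ∀ y x u → Linked (ByPosition y) (x ∷ u) → Unique (x ∷ u) →
                    SubstringFree _≟_ (x ∷ u) → IsSuperstring _≟_ (x ∷ u) y →
                    cost (x ∷ u) + position y x ≤ length y
  cost-byPosition y x [] _ _ _ sup =
    subst (_≤ length y) (+-comm (position y x) (length x)) (proj₂ (substring⇒occurs x y (sup (here refl))))
  cost-byPosition y x (h ∷ u) (x≤h ∷ sorted) ((x≢h ∷ _) ∷ unique) free sup = begin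
    dst x h + cost (h ∷ u) + px         ≤⟨ +-monoˡ-≤ px (+-monoˡ-≤ (cost (h ∷ u)) x→h≤gap) ⟩
    (ph ∸ px) + cost (h ∷ u) + px       ≡⟨ cong (_+ px) (+-comm (ph ∸ px) (cost (h ∷ u))) ⟩
    cost (h ∷ u) + (ph ∸ px) + px       ≡⟨ +-assoc (cost (h ∷ u)) (ph ∸ px) px ⟩
    cost (h ∷ u) + ((ph ∸ px) + px)     ≡⟨ cong (cost (h ∷ u) +_) (m∸n+n≡m x≤h) ⟩
    cost (h ∷ u) + ph                   ≤⟨ cost-byPosition y h u sorted unique
                                             (λ s∈ t∈ → free (there s∈) (there t∈)) (λ s∈ → sup (there s∈)) ⟩
    length y                            ∎
    where
    open ≤-Reasoning
    px ph : ℕ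
    px = position y x
    ph = position y h
    x→h≤gap : dst x h ≤ ph ∸ px
    x→h≤gap = dist≤gap y x h x≢h (free (there (here refl)) (here refl) (λ h≡x → x≢h (sym h≡x)))
                (substring⇒occurs x y (sup (here refl))) (substring⇒occurs h y (sup (there (here refl)))) x≤h

  superstring⇒ordering : ∀ {S y} → Unique S → SubstringFree _≟_ S → IsSuperstring _≟_ S y →
                         ∃[ u ] (u ↭ S × cost u ≤ length y)
  superstring⇒ordering {S} {y} unique free sup = sort S , sort-↭ S ,
    bound (sort S) (sort-↗ S) (Unique-resp-↭ (↭-sym (sort-↭ S)) unique)
      (λ s∈ t∈ → free (∈-resp-↭ (sort-↭ S) s∈) (∈-resp-↭ (sort-↭ S) t∈))
      (λ s∈ → sup (∈-resp-↭ (sort-↭ S) s∈))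
    where
    open Sort (On.decTotalOrder ≤-decTotalOrder (position y)) using (sort; sort-↭; sort-↗)
    bound : ∀ u → Linked (ByPosition y) u → Unique u → SubstringFree _≟_ u → IsSuperstring _≟_ u y →
            cost u ≤ length y
    bound []      _ _ _ _ = z≤n
    bound (x ∷ u) sorted unique′ free′ sup′ =
      ≤-trans (m≤m+n (cost (x ∷ u)) (position y x)) (cost-byPosition y x u sorted unique′ free′ sup′)

  IsOptimalOrdering : List (Str A) → List (Str A) → Set
  IsOptimalOrdering S u = u ↭ S × (∀ v → v ↭ S → cost u ≤ cost v)

  optimalOrdering : ∀ S → ∃[ u ] IsOptimalOrdering S u
  optimalOrdering S = u , argmin-all cost ↭-refl (All.tabulate (permutations-↭ S)) ,
    λ v v↭S → All.lookup (f[argmin]≤f[xs] S (permutations S)) (∈-permutations S v↭S)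
    where
    u : List (Str A)
    u = argmin cost S (permutations S)

  optimal⇒shortest : ∀ {S u} → Unique S → SubstringFree _≟_ S → IsOptimalOrdering S u →
                     IsShortestSuperstring _≟_ S (mergeAll _≟_ u)
  optimal⇒shortest {S} {u} unique free (u↭S , minimal) =
    (λ s∈ → mergeAll-superstring u (∈-resp-↭ (↭-sym u↭S) s∈)) , shortest
    where
    shortest : ∀ y → IsSuperstring _≟_ S y → length (mergeAll _≟_ u) ≤ length y
    shortest y sup with superstring⇒ordering unique free sup
    ... | v , v↭S , v≤y = begin
      length (mergeAll _≟_ u) ≡⟨ length-mergeAll u ⟩
      cost u                  ≤⟨ minimal v v↭S ⟩
      cost v                  ≤⟨ v≤y ⟩
      length y                ∎
      where open ≤-Reasoning

  merged? : ∀ s t u → Dec (Merged _≟_ s t u)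
  merged? s t []           = no λ { ([] , _ , ()) ; (_ ∷ _ , _ , ()) }
  merged? s t (x ∷ [])     = no λ { ([] , _ , ()) ; (_ ∷ [] , _ , ()) ; (_ ∷ _ ∷ _ , _ , ()) }
  merged? s t (x ∷ y ∷ u) with _≟s_ _≟_ x s | _≟s_ _≟_ y t | merged? s t (y ∷ u)
  ... | yes refl | yes refl | _                = yes ([] , u , refl)
  ... | _        | _        | yes (p , q , eq) = yes (x ∷ p , q , cong (x ∷_) eq)
  ... | no x≢s   | _        | no ¬later        = no λ
    { ([] , q , eq)    → x≢s (∷-injectiveˡ eq)
    ; (_ ∷ p , q , eq) → ¬later (p , q , ∷-injectiveʳ eq) }
  ... | yes _    | no y≢t   | no ¬later        = no λ
    { ([] , q , eq)    → y≢t (∷-injectiveˡ (∷-injectiveʳ eq))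
    ; (_ ∷ p , q , eq) → ¬later (p , q , ∷-injectiveʳ eq) }

  Merged⇒≢ : ∀ {s t u} → Unique u → Merged _≟_ s t u → s ≢ t
  Merged⇒≢ unique (P , Q , refl) refl =
    Unique[x∷xs]⇒x∉xs (Unique-shift P _ (_ ∷ Q) unique) (∈-++⁺ʳ P (here refl))

  ¬Merged-successor : ∀ P s v R {t} → Unique (P ++ s ∷ v ∷ R) → v ≢ t → ¬ Merged _≟_ s t (P ++ s ∷ v ∷ R)
  ¬Merged-successor P s v R unique v≢t (_ , _ , eq) = v≢t (∷-injectiveˡ (Unique-∷-suffix P unique eq))

  remove-at : ∀ {u} X Y {v P′ s t Q′} → Unique u → u ≡ X ++ v ∷ Y → X ++ Y ≡ P′ ++ s ∷ t ∷ Q′ →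
              u ↭ v ∷ P′ ++ s ∷ t ∷ Q′ × cost (P′ ++ s ∷ t ∷ Q′) ≤ cost u
  remove-at X Y {v} unique refl XY≡ =
    subst (λ Z → X ++ v ∷ Y ↭ v ∷ Z) XY≡ (shift v X Y) ,
    subst (λ Z → cost Z ≤ cost (X ++ v ∷ Y)) XY≡ (cost-remove X v Y unique)

  remove-elsewhere : ∀ P s t Q {v} → v ∈ P ++ s ∷ t ∷ Q → v ≢ s → v ≢ t → Unique (P ++ s ∷ t ∷ Q) →
                     ∃[ P′ ] ∃[ Q′ ] (P ++ s ∷ t ∷ Q ↭ v ∷ P′ ++ s ∷ t ∷ Q′ ×
                                      cost (P′ ++ s ∷ t ∷ Q′) ≤ cost (P ++ s ∷ t ∷ Q))
  remove-elsewhere P s t Q {v} v∈ v≢s v≢t unique with ∈-++⁻ P v∈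
  ... | inj₁ v∈P with ∈-∃++ v∈P
  ...   | P₁ , P₂ , refl = P₁ ++ P₂ , Q ,
          remove-at P₁ (P₂ ++ s ∷ t ∷ Q) unique (++-assoc P₁ (v ∷ P₂) _) (sym (++-assoc P₁ P₂ _))
  remove-elsewhere P s t Q v∈ v≢s v≢t unique | inj₂ (here v≡s)         = ⊥-elim (v≢s v≡s)
  remove-elsewhere P s t Q v∈ v≢s v≢t unique | inj₂ (there (here v≡t)) = ⊥-elim (v≢t v≡t)
  remove-elsewhere P s t Q {v} v∈ v≢s v≢t unique | inj₂ (there (there v∈Q)) with ∈-∃++ v∈Q
  ... | Q₁ , Q₂ , refl = P , Q₁ ++ Q₂ ,
        remove-at (P ++ s ∷ t ∷ Q₁) Q₂ unique (sym (++-assoc P (s ∷ t ∷ Q₁) (v ∷ Q₂))) (++-assoc P (s ∷ t ∷ Q₁) Q₂)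

  insert-between : ∀ {S u s t v} → Unique S → IsOptimalOrdering S u → Merged _≟_ s t u →
                   v ∈ S → v ≢ s → v ≢ t → dst s v + dst v t ≤ dst s t →
                   ∃[ u′ ] (IsOptimalOrdering S u′ × ¬ Merged _≟_ s t u′)
  insert-between {S} {s = s} {t} {v} S-unique (u↭S , minimal) (P , Q , refl) v∈S v≢s v≢t detour
    with remove-elsewhere P s t Q (∈-resp-↭ (↭-sym u↭S) v∈S) v≢s v≢t (Unique-resp-↭ (↭-sym u↭S) S-unique)
  ... | P′ , Q′ , u↭ , cost≤ = P′ ++ s ∷ v ∷ t ∷ Q′ , (u′↭S , minimal′) ,
        ¬Merged-successor P′ s v (t ∷ Q′) (Unique-resp-↭ (↭-sym u′↭S) S-unique) v≢t
    where
    u′↭S : P′ ++ s ∷ v ∷ t ∷ Q′ ↭ S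
    u′↭S = ↭-trans (subst₂ _↭_ (++-assoc P′ [ s ] (v ∷ t ∷ Q′)) (cong (v ∷_) (++-assoc P′ [ s ] (t ∷ Q′)))
                      (shift v (P′ ++ [ s ]) (t ∷ Q′)))
                   (↭-trans (↭-sym u↭) u↭S)
    minimal′ : ∀ w → w ↭ S → cost (P′ ++ s ∷ v ∷ t ∷ Q′) ≤ cost w
    minimal′ w w↭S = ≤-trans (cost-insert P′ s v t Q′ detour) (≤-trans cost≤ (minimal w w↭S))

  -- MGREEDY

  -- `with hasTail …` would not abstract the normalised goal; the proofs below scrutinise the
  -- underlying decisions instead.
  mgreedyAux-++ : ∀ acc L₁ L₂ →
                  mgreedyAux _≟_ acc (L₁ ++ L₂) ≡ mgreedyAux _≟_ (mgreedyAux _≟_ acc L₁) L₂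
  mgreedyAux-++ acc []             L₂ = refl
  mgreedyAux-++ acc ((s , t) ∷ L₁) L₂
    with any? (λ e → _≟s_ _≟_ (proj₁ e) s) acc | any? (λ e → _≟s_ _≟_ (proj₂ e) t) acc
  ... | yes _ | _     = mgreedyAux-++ acc L₁ L₂
  ... | no _  | yes _ = mgreedyAux-++ acc L₁ L₂
  ... | no _  | no _  = mgreedyAux-++ (acc ++ [ (s , t) ]) L₁ L₂

  mgreedyAux-extends : ∀ acc L → ∃[ B ] (mgreedyAux _≟_ acc L ≡ acc ++ B × (∀ {e} → e ∈ B → e ∈ L))
  mgreedyAux-extends acc []             = [] , sym (++-identityʳ acc) , λ ()
  mgreedyAux-extends acc ((s , t) ∷ L)
    with any? (λ e → _≟s_ _≟_ (proj₁ e) s) acc | any? (λ e → _≟s_ _≟_ (proj₂ e) t) acc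
  ... | yes _ | _     = let B , eq , B⊆L = mgreedyAux-extends acc L in B , eq , λ e∈ → there (B⊆L e∈)
  ... | no _  | yes _ = let B , eq , B⊆L = mgreedyAux-extends acc L in B , eq , λ e∈ → there (B⊆L e∈)
  ... | no _  | no _  = let B , eq , B⊆L = mgreedyAux-extends (acc ++ [ (s , t) ]) L in
    (s , t) ∷ B , trans eq (++-assoc acc [ (s , t) ] B) , λ { (here refl) → here refl ; (there e∈) → there (B⊆L e∈) }

  mgreedy⊆ : ∀ L {e} → e ∈ mgreedy _≟_ L → e ∈ L
  mgreedy⊆ L e∈ with mgreedyAux-extends [] L
  ... | B , eq , B⊆L = B⊆L (subst (_ ∈_) eq e∈)

  mgreedyAux-AllPairs : ∀ (R : Edge A → Edge A → Set) acc L → AllPairs R acc →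
                        All (λ e → All (R e) L) acc → AllPairs R L → AllPairs R (mgreedyAux _≟_ acc L)
  mgreedyAux-AllPairs R acc [] pairs _ _ = pairs
  mgreedyAux-AllPairs R acc ((s , t) ∷ L) pairs acc-L (st-L ∷ L-pairs)
    with any? (λ e → _≟s_ _≟_ (proj₁ e) s) acc | any? (λ e → _≟s_ _≟_ (proj₂ e) t) acc
  ... | yes _ | _     = mgreedyAux-AllPairs R acc L pairs (All.map All.tail acc-L) L-pairs
  ... | no _  | yes _ = mgreedyAux-AllPairs R acc L pairs (All.map All.tail acc-L) L-pairs
  ... | no _  | no _  = mgreedyAux-AllPairs R (acc ++ [ (s , t) ]) L
                          (AllPairs-∷ʳ pairs (All.map All.head acc-L))
                          (All-++⁺ (All.map All.tail acc-L) (st-L ∷ [])) L-pairs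

  mgreedyAux-distinctTails : ∀ acc L → AllPairs (_≢_ on proj₁) acc →
                             AllPairs (_≢_ on proj₁) (mgreedyAux _≟_ acc L)
  mgreedyAux-distinctTails acc [] distinct = distinct
  mgreedyAux-distinctTails acc ((s , t) ∷ L) distinct
    with any? (λ e → _≟s_ _≟_ (proj₁ e) s) acc | any? (λ e → _≟s_ _≟_ (proj₂ e) t) acc
  ... | yes _        | _     = mgreedyAux-distinctTails acc L distinct
  ... | no _         | yes _ = mgreedyAux-distinctTails acc L distinct
  ... | no s-is-free | no _  =
    mgreedyAux-distinctTails (acc ++ [ (s , t) ]) L (AllPairs-∷ʳ distinct (¬Any⇒All¬ acc s-is-free))

  mgreedyAux-distinctHeads : ∀ acc L → AllPairs (_≢_ on proj₂) acc →
                             AllPairs (_≢_ on proj₂) (mgreedyAux _≟_ acc L)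
  mgreedyAux-distinctHeads acc [] distinct = distinct
  mgreedyAux-distinctHeads acc ((s , t) ∷ L) distinct
    with any? (λ e → _≟s_ _≟_ (proj₁ e) s) acc | any? (λ e → _≟s_ _≟_ (proj₂ e) t) acc
  ... | yes _ | _            = mgreedyAux-distinctHeads acc L distinct
  ... | no _  | yes _        = mgreedyAux-distinctHeads acc L distinct
  ... | no _  | no t-is-free =
    mgreedyAux-distinctHeads (acc ++ [ (s , t) ]) L (AllPairs-∷ʳ distinct (¬Any⇒All¬ acc t-is-free))

  mgreedyAux-rejects : ∀ acc a y L {a′} → AllPairs (_≢_ on proj₁) acc →
                       (a , a′) ∈ mgreedyAux _≟_ acc ((a , y) ∷ L) → (a , a′) ∉ acc → y ≢ a′ →
                       ∃[ e ] (proj₂ e ≡ y × Before (mgreedyAux _≟_ acc ((a , y) ∷ L)) e (a , a′))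
  mgreedyAux-rejects acc a y L {a′} distinct aa′∈ aa′∉acc y≢a′
    with any? (λ e → _≟s_ _≟_ (proj₁ e) a) acc | any? (λ e → _≟s_ _≟_ (proj₂ e) y) acc
  ... | yes a-taken | _ with mgreedyAux-extends acc L | find a-taken
  ...   | B , eq , _ | e , e∈acc , e→a = ⊥-elim (aa′∉acc (subst (_∈ acc) e≡aa′ e∈acc))
    where
    e≡aa′ : e ≡ (a , a′)
    e≡aa′ = AllPairs-≢-injective proj₁ (mgreedyAux-distinctTails acc L distinct)
              (subst (e ∈_) (sym eq) (∈-++⁺ˡ e∈acc)) aa′∈ e→a
  mgreedyAux-rejects acc a y L {a′} distinct aa′∈ aa′∉acc y≢a′
    | no _ | yes y-taken with mgreedyAux-extends acc L | find y-taken
  ...   | B , eq , _ | e , e∈acc , e→y with ∈-++⁻ acc (subst ((a , a′) ∈_) eq aa′∈)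
  ...     | inj₁ aa′∈acc = ⊥-elim (aa′∉acc aa′∈acc)
  ...     | inj₂ aa′∈B   = e , e→y , subst (λ G → Before G e (a , a′)) (sym eq) (Before-++ e∈acc aa′∈B)
  mgreedyAux-rejects acc a y L {a′} distinct aa′∈ aa′∉acc y≢a′
    | no a-free | no y-free with mgreedyAux-extends (acc ++ [ (a , y) ]) L
  ... | B , eq , _ = ⊥-elim (y≢a′ (cong proj₂ (AllPairs-≢-injective proj₁
          (mgreedyAux-distinctTails (acc ++ [ (a , y) ]) L (AllPairs-∷ʳ distinct (¬Any⇒All¬ acc a-free)))
          (subst ((a , y) ∈_) (sym eq) (∈-++⁺ˡ (∈-++⁺ʳ acc (here refl)))) aa′∈ refl)))

  mgreedy-rejects : ∀ L₁ a y L₂ {a′} → (a , a′) ∈ mgreedy _≟_ (L₁ ++ (a , y) ∷ L₂) →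
                    (a , a′) ∉ L₁ → y ≢ a′ →
                    ∃[ e ] (proj₂ e ≡ y × Before (mgreedy _≟_ (L₁ ++ (a , y) ∷ L₂)) e (a , a′))
  mgreedy-rejects L₁ a y L₂ aa′∈ aa′∉L₁ y≢a′ rewrite mgreedyAux-++ [] L₁ ((a , y) ∷ L₂) =
    mgreedyAux-rejects (mgreedy _≟_ L₁) a y L₂ (mgreedyAux-distinctTails [] L₁ []) aa′∈
      (λ aa′∈acc → aa′∉L₁ (mgreedy⊆ L₁ aa′∈acc)) y≢a′

  -- Small cycles

  _≥ov_ : Edge A → Edge A → Set
  e ≥ov f = ovl (proj₁ f) (proj₂ f) ≤ ovl (proj₁ e) (proj₂ e)

  module SmallCycle
    (S : List (Str A)) (S-free : SubstringFree _≟_ S)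
    (L : List (Edge A)) (L-sorted : SortedPairs _≟_ S L)
    (v₀ : Str A) (vs : List (Str A))
    (is-cycle : IsCycleOf _≟_ (mgreedy _≟_ L) (v₀ ∷ vs))
    (small : 2 * weight _≟_ (v₀ ∷ vs) < closingOv _≟_ (mgreedy _≟_ L) (v₀ ∷ vs))
    where

    open Cycle v₀ vs public

    G : List (Edge A)
    G = mgreedy _≟_ L

    cycle-unique : Unique (v₀ ∷ vs)
    cycle-unique = proj₁ (proj₂ is-cycle)

    edge∈G : ∀ n → (vertex n , vertex (suc n)) ∈ G
    edge∈G n = proj₂ (proj₂ is-cycle) (edge-∈ n)

    pair∈S : ∀ {a b} → (a , b) ∈ L → a ∈ S × b ∈ S
    pair∈S ab∈ = ∈-cartesianProduct⁻ S S (∈-resp-↭ (proj₁ L-sorted) ab∈)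

    pair∈L : ∀ {a b} → a ∈ S → b ∈ S → (a , b) ∈ L
    pair∈L a∈ b∈ = ∈-resp-↭ (↭-sym (proj₁ L-sorted)) (∈-cartesianProduct⁺ a∈ b∈)

    vertex∈S : ∀ n → vertex n ∈ S
    vertex∈S n = proj₁ (pair∈S (mgreedy⊆ L (edge∈G n)))

    L-≥ov : AllPairs _≥ov_ L
    L-≥ov = Linked⇒AllPairs (λ e≥f f≥g → ≤-trans f≥g e≥f) (proj₂ L-sorted)

    G-≥ov : AllPairs _≥ov_ G
    G-≥ov = mgreedyAux-AllPairs _≥ov_ [] L [] [] L-≥ov

    G-tails : AllPairs (_≢_ on proj₁) G
    G-tails = mgreedyAux-distinctTails [] L []

    G-heads : AllPairs (_≢_ on proj₂) G
    G-heads = mgreedyAux-distinctHeads [] L []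

    G-unique : Unique G
    G-unique = AllPairs.map (λ tails≢ e≡f → tails≢ (cong proj₁ e≡f)) G-tails

    inCycle? : Decidable (_∈ cycleEdges _≟_ (v₀ ∷ vs))
    inCycle? e = any? (λ f → _≟e_ _≟_ e f) (cycleEdges _≟_ (v₀ ∷ vs))

    closing : ∃[ ec ] (last (filter inCycle? G) ≡ just ec)
    closing = last-filter-just inCycle? (edge∈G 0) (edge-∈ 0)

    module ClosingEdge (ec : Edge A) (ec-last : last (filter inCycle? G) ≡ just ec) where

      ec∈G : ec ∈ G
      ec∈G = proj₁ (last-filter-∈ inCycle? G ec-last)

      ec∈cycle : ec ∈ cycleEdges _≟_ (v₀ ∷ vs)
      ec∈cycle = proj₂ (last-filter-∈ inCycle? G ec-last)

      o : ℕ
      o = ovl (proj₁ ec) (proj₂ ec)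

      closing-last : ∀ {f} → f ∈ cycleEdges _≟_ (v₀ ∷ vs) → ¬ Before G ec f
      closing-last = last-filter-¬Before inCycle? G-unique ec-last

      o≤ovLen : ∀ n → o ≤ ovl (vertex n) (vertex (suc n))
      o≤ovLen n with _≟e_ _≟_ (vertex n , vertex (suc n)) ec
      ... | yes e≡ec = ≤-reflexive (cong (λ e → ovl (proj₁ e) (proj₂ e)) (sym e≡ec))
      ... | no  e≢ec with Before-total (edge∈G n) ec∈G e≢ec
      ...   | inj₁ e-first  = AllPairs-Before G-≥ov e-first
      ...   | inj₂ ec-first = ⊥-elim (closing-last (edge-∈ n) ec-first)

      d : ℕ → ℕ
      d n = dst (vertex n) (vertex (suc n))

      span : ℕ → ℕ → ℕ
      span n zero    = 0
      span n (suc r) = d n + span (suc n) r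

      offset : ℕ → ℕ
      offset = span 0

      w : ℕ
      w = offset k

      sum-applyUpTo≡span : ∀ {g : ℕ → ℕ} n r → (∀ i → g i ≡ d (n + i)) → sum (applyUpTo g r) ≡ span n r
      sum-applyUpTo≡span n zero    _   = refl
      sum-applyUpTo≡span n (suc r) g≗d = cong₂ _+_ (trans (g≗d 0) (cong d (+-identityʳ n)))
        (sum-applyUpTo≡span (suc n) r (λ i → trans (g≗d (suc i)) (cong d (+-suc n i))))

      weight≡w : weight _≟_ (v₀ ∷ vs) ≡ w
      weight≡w = begin
        weight _≟_ (v₀ ∷ vs)                                           ≡⟨ cong (λ E → sum (map edge-dist E)) cycleEdges≡ ⟩
        sum (map edge-dist (applyUpTo (λ i → vertex i , vertex (suc i)) k)) ≡⟨ cong sum (map-applyUpTo (λ i → vertex i , vertex (suc i)) edge-dist k) ⟩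
        sum (applyUpTo d k)                                            ≡⟨ sum-applyUpTo≡span 0 k (λ _ → refl) ⟩
        w                                                              ∎
        where
        open ≡-Reasoning
        edge-dist : Edge A → ℕ
        edge-dist e = dst (proj₁ e) (proj₂ e)

      2w<o : 2 * w < o
      2w<o = subst₂ (λ W O → 2 * W < O) weight≡w (cong (maybe (λ e → ovl (proj₁ e) (proj₂ e)) 0) ec-last) small

      2w<length : ∀ n → 2 * w < length (vertex n)
      2w<length n = <-≤-trans 2w<o (≤-trans (o≤ovLen n) (ovLen≤length (vertex n) (vertex (suc n))))

      d-positive : ∀ n → 1 ≤ d n
      d-positive n = dist-positive (vertex n) (vertex (suc n)) (≤-trans (s≤s z≤n) (2w<length n))
                       (S-free (vertex∈S n) (vertex∈S (suc n)))

      d-+k : ∀ n → d (n + k) ≡ d n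
      d-+k n = cong₂ dst (vertex-+k n) (vertex-+k (suc n))

      span-+ : ∀ n r r′ → span n (r + r′) ≡ span n r + span (n + r) r′
      span-+ n zero    r′ = cong (λ i → span i r′) (sym (+-identityʳ n))
      span-+ n (suc r) r′ = begin
        d n + span (suc n) (r + r′)                   ≡⟨ cong (d n +_) (span-+ (suc n) r r′) ⟩
        d n + (span (suc n) r + span (suc n + r) r′)  ≡⟨ cong (λ i → d n + (span (suc n) r + span i r′)) (sym (+-suc n r)) ⟩
        d n + (span (suc n) r + span (n + suc r) r′)  ≡⟨ +-assoc (d n) _ _ ⟨
        d n + span (suc n) r + span (n + suc r) r′    ∎
        where open ≡-Reasoning

      offset-+ : ∀ n r → offset (n + r) ≡ offset n + span n r
      offset-+ = span-+ 0

      offset-suc : ∀ n → offset (suc n) ≡ offset n + d n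
      offset-suc n = trans (cong offset (+-comm 1 n)) (trans (offset-+ n 1) (cong (offset n +_) (+-identityʳ (d n))))

      offset-mono : ∀ {a b} → a ≤ b → offset a ≤ offset b
      offset-mono {a} {b} a≤b = subst (offset a ≤_) (trans (sym (offset-+ a (b ∸ a))) (cong offset (m+[n∸m]≡n a≤b)))
                                  (m≤m+n (offset a) _)

      r≤span : ∀ n r → r ≤ span n r
      r≤span n zero    = z≤n
      r≤span n (suc r) = +-mono-≤ (d-positive n) (r≤span (suc n) r)

      span-suc : ∀ n → span (suc n) k ≡ span n k
      span-suc n = +-cancelˡ-≡ (d n) _ _ (begin
        span n (1 + k)             ≡⟨ cong (span n) (+-comm 1 k) ⟩
        span n (k + 1)             ≡⟨ span-+ n k 1 ⟩
        span n k + (d (n + k) + 0) ≡⟨ cong (span n k +_) (trans (+-identityʳ _) (d-+k n)) ⟩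
        span n k + d n             ≡⟨ +-comm (span n k) (d n) ⟩
        d n + span n k             ∎)
        where open ≡-Reasoning

      span-k : ∀ n → span n k ≡ w
      span-k zero    = refl
      span-k (suc n) = trans (span-suc n) (span-k n)

      offset-+k : ∀ n → offset (n + k) ≡ offset n + w
      offset-+k n = trans (offset-+ n k) (cong (offset n +_) (span-k n))

      span<w : ∀ n {r} → r < k → span n r < w
      span<w n {r} r<k = begin-strict
        span n r                         <⟨ m<m+n (span n r) (<-≤-trans (m<n⇒0<n∸m r<k) (r≤span (n + r) (k ∸ r))) ⟩
        span n r + span (n + r) (k ∸ r)  ≡⟨ span-+ n r (k ∸ r) ⟨
        span n (r + (k ∸ r))             ≡⟨ cong (span n) (m+[n∸m]≡n (<⇒≤ r<k)) ⟩
        span n k                         ≡⟨ span-k n ⟩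
        w                                ∎
        where open ≤-Reasoning

      1≤w : 1 ≤ w
      1≤w = ≤-trans (s≤s z≤n) (r≤span 0 k)

      walk : ∀ r n m → span n r + m < length (vertex n) → vertex n !? (span n r + m) ≡ vertex (n + r) !? m
      walk zero    n m _ = cong (λ i → vertex i !? m) (sym (+-identityʳ n))
      walk (suc r) n m in-vertex = begin
        vertex n !? (d n + span (suc n) r + m)   ≡⟨ cong (vertex n !?_) (+-assoc (d n) _ m) ⟩
        vertex n !? (d n + (span (suc n) r + m)) ≡⟨ ovLen-!? (vertex n) (vertex (suc n)) _ in-overlap ⟩
        vertex (suc n) !? (span (suc n) r + m)   ≡⟨ walk r (suc n) m (<-≤-trans in-overlap (ovLen≤lengthʳ (vertex n) (vertex (suc n)))) ⟩
        vertex (suc n + r) !? m                  ≡⟨ cong (λ i → vertex i !? m) (+-suc n r) ⟨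
        vertex (n + suc r) !? m                  ∎
        where
        open ≡-Reasoning
        in-overlap : span (suc n) r + m < ovl (vertex n) (vertex (suc n))
        in-overlap = +-cancelˡ-< (d n) _ _
          (subst₂ _<_ (+-assoc (d n) _ m) (sym (dist+ovLen≡length (vertex n) (vertex (suc n)))) in-vertex)

      block : ℕ → ℕ
      block zero    = 0
      block (suc x) with suc x <? offset (suc (block x))
      ... | yes _ = block x
      ... | no  _ = suc (block x)

      block-spec : ∀ x → offset (block x) ≤ x × x < offset (suc (block x))
      block-spec zero = z≤n , ≤-trans (d-positive 0) (m≤m+n (d 0) 0)
      block-spec (suc x) with suc x <? offset (suc (block x)) | block-spec x
      ... | yes in-block | lo , _  = m≤n⇒m≤1+n lo , in-block
      ... | no  ¬in-block | _ , hi = ≮⇒≥ ¬in-block , (begin-strict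
        suc x                                ≤⟨ hi ⟩
        offset (suc (block x))               <⟨ m<m+n _ (d-positive (suc (block x))) ⟩
        offset (suc (block x)) + d (suc (block x)) ≡⟨ offset-suc (suc (block x)) ⟨
        offset (suc (suc (block x)))         ∎)
        where open ≤-Reasoning

      within-block : ∀ x → x ∸ offset (block x) < d (block x)
      within-block x = +-cancelˡ-< (offset (block x)) _ _
        (subst₂ _<_ (sym (m+[n∸m]≡n (proj₁ (block-spec x)))) (offset-suc (block x)) (proj₂ (block-spec x)))

      word : ℕ → Maybe A
      word x = vertex (block x) !? (x ∸ offset (block x))

      vertex-in-word-before-block : ∀ n m → m < length (vertex n) → n ≤ block (offset n + m) →
                                    vertex n !? m ≡ word (offset n + m)
      vertex-in-word-before-block n m m<len n≤b = begin
        vertex n !? m                 ≡⟨ cong (vertex n !?_) m≡ ⟨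
        vertex n !? (span n r + m′)   ≡⟨ walk r n m′ (subst (_< length (vertex n)) (sym m≡) m<len) ⟩
        vertex (n + r) !? m′          ≡⟨ cong (λ i → vertex i !? m′) n+r≡b ⟩
        vertex b !? m′                ≡⟨ cong (vertex b !?_) m′≡ ⟨
        word (offset n + m)           ∎
        where
        open ≡-Reasoning
        b r : ℕ
        b = block (offset n + m)
        r = b ∸ n
        n+r≡b : n + r ≡ b
        n+r≡b = m+[n∸m]≡n n≤b
        offset-b : offset b ≡ offset n + span n r
        offset-b = trans (cong offset (sym n+r≡b)) (offset-+ n r)
        span≤m : span n r ≤ m
        span≤m = +-cancelˡ-≤ (offset n) _ _ (subst (_≤ offset n + m) offset-b (proj₁ (block-spec (offset n + m))))
        m′ : ℕ
        m′ = m ∸ span n r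
        m≡ : span n r + m′ ≡ m
        m≡ = m+[n∸m]≡n span≤m
        m′≡ : offset n + m ∸ offset b ≡ m′
        m′≡ = trans (cong (offset n + m ∸_) offset-b) ([m+n]∸[m+o]≡n∸o (offset n) m (span n r))

      vertex-in-word-after-block : ∀ n m → block (offset n + m) ≤ n → vertex n !? m ≡ word (offset n + m)
      vertex-in-word-after-block n m b≤n = sym (begin
        word (offset n + m)           ≡⟨ cong (vertex b !?_) m′≡ ⟩
        vertex b !? (span b r + m)    ≡⟨ walk r b m in-b ⟩
        vertex (b + r) !? m           ≡⟨ cong (λ i → vertex i !? m) b+r≡n ⟩
        vertex n !? m                 ∎)
        where
        open ≡-Reasoning
        b r : ℕ
        b = block (offset n + m)
        r = n ∸ b
        b+r≡n : b + r ≡ n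
        b+r≡n = m+[n∸m]≡n b≤n
        m′≡ : offset n + m ∸ offset b ≡ span b r + m
        m′≡ = begin
          offset n + m ∸ offset b                ≡⟨ cong (λ i → offset i + m ∸ offset b) b+r≡n ⟨
          offset (b + r) + m ∸ offset b          ≡⟨ cong (λ i → i + m ∸ offset b) (offset-+ b r) ⟩
          offset b + span b r + m ∸ offset b     ≡⟨ cong (_∸ offset b) (+-assoc (offset b) _ m) ⟩
          offset b + (span b r + m) ∸ offset b   ≡⟨ m+n∸m≡n (offset b) _ ⟩
          span b r + m                           ∎
        in-b : span b r + m < length (vertex b)
        in-b = subst (_< length (vertex b)) m′≡
                 (<-≤-trans (within-block (offset n + m)) (dist≤length (vertex b) (vertex (suc b))))

      vertex-in-word : ∀ n m → m < length (vertex n) → vertex n !? m ≡ word (offset n + m)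
      vertex-in-word n m m<len =
        [ vertex-in-word-before-block n m m<len , vertex-in-word-after-block n m ]′ (≤-total n (block (offset n + m)))

      word-+w : ∀ x → word (x + w) ≡ word x
      word-+w x = sym (begin
        word x                        ≡⟨ cong (_!? m) (vertex-+k b) ⟨
        vertex (b + k) !? m           ≡⟨ vertex-in-word (b + k) m m<len ⟩
        word (offset (b + k) + m)     ≡⟨ cong word position≡ ⟩
        word (x + w)                  ∎)
        where
        open ≡-Reasoning
        b m : ℕ
        b = block x
        m = x ∸ offset b
        m<len : m < length (vertex (b + k))
        m<len = subst (λ v → m < length v) (sym (vertex-+k b))
                  (<-≤-trans (within-block x) (dist≤length (vertex b) (vertex (suc b))))
        position≡ : offset (b + k) + m ≡ x + w
        position≡ = begin
          offset (b + k) + m     ≡⟨ cong (_+ m) (offset-+k b) ⟩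
          offset b + w + m       ≡⟨ +-assoc (offset b) w m ⟩
          offset b + (w + m)     ≡⟨ cong (offset b +_) (+-comm w m) ⟩
          offset b + (m + w)     ≡⟨ +-assoc (offset b) m w ⟨
          offset b + m + w       ≡⟨ cong (_+ w) (m+[n∸m]≡n (proj₁ (block-spec x))) ⟩
          x + w                  ∎

      word-+qw : ∀ q x → word (x + q * w) ≡ word x
      word-+qw zero    x = cong word (+-identityʳ x)
      word-+qw (suc q) x = begin
        word (x + (w + q * w)) ≡⟨ cong word (trans (cong (x +_) (+-comm w (q * w))) (sym (+-assoc x (q * w) w))) ⟩
        word (x + q * w + w)   ≡⟨ word-+w (x + q * w) ⟩
        word (x + q * w)       ≡⟨ word-+qw q x ⟩
        word x                 ∎
        where open ≡-Reasoning

      instance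
        w-nonZero : NonZero w
        w-nonZero = >-nonZero 1≤w

      word-shift-invariant : ∀ P e → (∀ m → m < w → word (P + m) ≡ word (P + e + m)) →
                             ∀ x → word (x + e) ≡ word x
      word-shift-invariant P e agree x = sym (begin
        word x                   ≡⟨ word-+qw P x ⟨
        word (x + P * w)         ≡⟨ cong word x+Pw≡ ⟩
        word (P + r + q * w)     ≡⟨ word-+qw q (P + r) ⟩
        word (P + r)             ≡⟨ agree r (m%n<n t w) ⟩
        word (P + e + r)         ≡⟨ word-+qw q (P + e + r) ⟨
        word (P + e + r + q * w) ≡⟨ cong word shifted≡ ⟩
        word (x + e + P * w)     ≡⟨ word-+qw P (x + e) ⟩
        word (x + e)             ∎)
        where
        open ≡-Reasoning
        t r q : ℕ
        t = x + P * w ∸ P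
        r = t % w
        q = t / w
        x+Pw≡ : x + P * w ≡ P + r + q * w
        x+Pw≡ = begin
          x + P * w         ≡⟨ m+[n∸m]≡n (≤-trans (m≤m*n P w) (m≤n+m (P * w) x)) ⟨
          P + t             ≡⟨ cong (P +_) (m≡m%n+[m/n]*n t w) ⟩
          P + (r + q * w)   ≡⟨ +-assoc P r (q * w) ⟨
          P + r + q * w     ∎
        shifted≡ : P + e + r + q * w ≡ x + e + P * w
        shifted≡ = begin
          P + e + r + q * w ≡⟨ cong (_+ q * w) (xy∙z≈xz∙y P e r) ⟩
          P + r + e + q * w ≡⟨ xy∙z≈xz∙y (P + r) e (q * w) ⟩
          P + r + q * w + e ≡⟨ cong (_+ e) x+Pw≡ ⟨
          x + P * w + e     ≡⟨ xy∙z≈xz∙y x (P * w) e ⟩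
          x + e + P * w     ∎

      vertices-agree : ∀ a b δ → (∀ m → word (offset a + δ + m) ≡ word (offset b + m)) →
                       ∀ m → δ + m < length (vertex a) → m < length (vertex b) →
                       vertex a !? (δ + m) ≡ vertex b !? m
      vertices-agree a b δ shift m in-a in-b = begin
        vertex a !? (δ + m)       ≡⟨ vertex-in-word a (δ + m) in-a ⟩
        word (offset a + (δ + m)) ≡⟨ cong word (+-assoc (offset a) δ m) ⟨
        word (offset a + δ + m)   ≡⟨ shift m ⟩
        word (offset b + m)       ≡⟨ vertex-in-word b m in-b ⟨
        vertex b !? m             ∎
        where open ≡-Reasoning

      dist≤word-shift : ∀ a b δ → (vertex a ≡ vertex b → 1 ≤ δ) →
                        (∀ m → word (offset a + δ + m) ≡ word (offset b + m)) →
                        dst (vertex a) (vertex b) ≤ δ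
      dist≤word-shift a b δ δ-pos shift = dist≤agreeing-shift (vertex a) (vertex b) δ δ-pos
        (λ a≢b → S-free (vertex∈S b) (vertex∈S a) (λ b≡a → a≢b (sym b≡a))) (vertices-agree a b δ shift)

      greedy-takes-longer : ∀ i → ovl (vertex i) (vertex (suc i)) < ovl (vertex i) (proj₂ ec) → ⊥
      greedy-takes-longer i ov< with ∈-∃++ (pair∈L (vertex∈S i) (proj₂ (pair∈S (mgreedy⊆ L ec∈G))))
      ... | L₁ , L₂ , L≡ = closing-last (edge-∈ i) ec-first
        where
        a a′ y : Str A
        a = vertex i
        a′ = vertex (suc i)
        y = proj₂ ec
        aa′∈ : (a , a′) ∈ mgreedy _≟_ (L₁ ++ (a , y) ∷ L₂)
        aa′∈ = subst (λ L′ → (a , a′) ∈ mgreedy _≟_ L′) L≡ (edge∈G i)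
        aa′∉L₁ : (a , a′) ∉ L₁
        aa′∉L₁ aa′∈L₁ with ∈-∃++ aa′∈L₁
        ... | X , Y , L₁≡ = <⇒≱ ov< (AllPairs-Before L-≥ov (X , Y , L₂ ,
              trans L≡ (trans (cong (_++ (a , y) ∷ L₂) L₁≡) (++-assoc X _ _))))
        y≢a′ : y ≢ a′
        y≢a′ y≡a′ = <-irrefl (cong (ovl a) (sym y≡a′)) ov<
        ec-first : Before G ec (a , a′)
        ec-first with mgreedy-rejects L₁ a y L₂ aa′∈ aa′∉L₁ y≢a′
        ... | e , e→y , e-first = subst (λ f → Before G f (a , a′)) e≡ec e-first′
          where
          e-first′ : Before G e (a , a′)
          e-first′ = subst (λ L′ → Before (mgreedy _≟_ L′) e (a , a′)) (sym L≡) e-first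
          e≡ec : e ≡ ec
          e≡ec = AllPairs-≢-injective proj₂ G-heads (Before-∈ e-first′) ec∈G e→y

      no-shorter-period : ∀ e → 1 ≤ e → e < w → (∀ x → word (x + e) ≡ word x) → ⊥
      no-shorter-period e 1≤e e<w e-period with ∈-edge ec∈cycle
      ... | j , ec≡ = greedy-takes-longer i
            (subst (λ y → ovl (vertex i) (vertex (suc i)) < ovl (vertex i) y) (sym (cong proj₂ ec≡))
              (dist<⇒ovLen> (vertex i) (vertex J) (vertex (suc i))
                (≤-<-trans (dist≤word-shift i J δ δ-pos e-shift) (within-block z))))
        where
        J z i δ : ℕ
        J = suc j
        z = offset J + e
        i = block z
        δ = z ∸ offset i
        J≤i : J ≤ i
        J≤i with J ≤? i
        ... | yes J≤i = J≤i
        ... | no  J≰i = ⊥-elim (<⇒≱ (proj₂ (block-spec z))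
                          (≤-trans (offset-mono (≰⇒> J≰i)) (m≤m+n (offset J) e)))
        δ-pos : vertex i ≡ vertex J → 1 ≤ δ
        δ-pos i~J with ≡-mod⇒≡⊎+≤ k J≤i (vertex-injective-% cycle-unique {J} {i} (sym i~J))
        ... | inj₁ J≡i    = subst (1 ≤_) (sym (trans (cong (λ b → z ∸ offset b) (sym J≡i)) (m+n∸m≡n (offset J) e))) 1≤e
        ... | inj₂ J+k≤i  = ⊥-elim (<⇒≱ (+-monoʳ-< (offset J) e<w) (begin
          offset J + w     ≡⟨ offset-+k J ⟨
          offset (J + k)   ≤⟨ offset-mono J+k≤i ⟩
          offset i         ≤⟨ proj₁ (block-spec z) ⟩
          offset J + e     ∎))
          where open ≤-Reasoning
        e-shift : ∀ m → word (offset i + δ + m) ≡ word (offset J + m)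
        e-shift m = begin
          word (offset i + δ + m)  ≡⟨ cong (λ x → word (x + m)) (m+[n∸m]≡n (proj₁ (block-spec z))) ⟩
          word (offset J + e + m)  ≡⟨ cong word (xy∙z≈xz∙y (offset J) e m) ⟩
          word (offset J + m + e)  ≡⟨ e-period (offset J + m) ⟩
          word (offset J + m)      ∎
          where open ≡-Reasoning

      shortcut⇒long-overlap : ∀ n r → r < k → dst (vertex n) (vertex (n + r)) < span n r →
                              w ≤ ovl (vertex n) (vertex (n + r))
      shortcut⇒long-overlap n r r<k shortcut = +-cancelˡ-≤ δ w _ (begin
        δ + w                                  ≤⟨ +-monoˡ-≤ w (<⇒≤ (<-trans shortcut (span<w n r<k))) ⟩
        w + w                                  ≡⟨ cong (w +_) (+-identityʳ w) ⟨
        2 * w                                  <⟨ 2w<length n ⟩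
        length (vertex n)                      ≡⟨ dist+ovLen≡length (vertex n) (vertex (n + r)) ⟨
        δ + ovl (vertex n) (vertex (n + r))    ∎)
        where
        open ≤-Reasoning
        δ : ℕ
        δ = dst (vertex n) (vertex (n + r))

      shortcut⇒period : ∀ n r → r < k → dst (vertex n) (vertex (n + r)) < span n r →
                        ∀ x → word (x + (span n r ∸ dst (vertex n) (vertex (n + r)))) ≡ word x
      shortcut⇒period n r r<k shortcut = word-shift-invariant P e agree
        where
        s t : Str A
        s = vertex n
        t = vertex (n + r)
        δ e P : ℕ
        δ = dst s t
        e = span n r ∸ δ
        P = offset n + δ
        P+e≡ : P + e ≡ offset (n + r)
        P+e≡ = begin
          offset n + δ + e        ≡⟨ +-assoc (offset n) δ e ⟩
          offset n + (δ + e)      ≡⟨ cong (offset n +_) (m+[n∸m]≡n (<⇒≤ shortcut)) ⟩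
          offset n + span n r     ≡⟨ offset-+ n r ⟨
          offset (n + r)          ∎
          where open ≡-Reasoning
        agree : ∀ m → m < w → word (P + m) ≡ word (P + e + m)
        agree m m<w = begin
          word (offset n + δ + m)   ≡⟨ cong word (+-assoc (offset n) δ m) ⟩
          word (offset n + (δ + m)) ≡⟨ vertex-in-word n (δ + m) in-s ⟨
          s !? (δ + m)              ≡⟨ ovLen-!? s t m m<ov ⟩
          t !? m                    ≡⟨ vertex-in-word (n + r) m (<-≤-trans m<ov (ovLen≤lengthʳ s t)) ⟩
          word (offset (n + r) + m) ≡⟨ cong (λ x → word (x + m)) P+e≡ ⟨
          word (P + e + m)          ∎
          where
          open ≡-Reasoning
          m<ov : m < ovl s t
          m<ov = <-≤-trans m<w (shortcut⇒long-overlap n r r<k shortcut)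
          in-s : δ + m < length s
          in-s = subst (δ + m <_) (dist+ovLen≡length s t) (+-monoʳ-< δ m<ov)

      span≤dist : ∀ n r → r < k → span n r ≤ dst (vertex n) (vertex (n + r))
      span≤dist n r r<k with span n r ≤? dst (vertex n) (vertex (n + r))
      ... | yes span≤ = span≤
      ... | no  span≰ = ⊥-elim (no-shorter-period (span n r ∸ δ) (m<n⇒0<n∸m shortcut)
                          (≤-<-trans (m∸n≤m (span n r) δ) (span<w n r<k)) (shortcut⇒period n r r<k shortcut))
        where
        δ : ℕ
        δ = dst (vertex n) (vertex (n + r))
        shortcut : δ < span n r
        shortcut = ≰⇒> span≰

      detour : ∀ n r → 2 ≤ r → r < k →
               d n + dst (vertex (suc n)) (vertex (n + r)) ≤ dst (vertex n) (vertex (n + r))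
      detour n (suc r) (s≤s 1≤r) r<k = begin
        d n + dst (vertex (suc n)) (vertex (n + suc r)) ≡⟨ cong (λ i → d n + dst (vertex (suc n)) (vertex i)) (+-suc n r) ⟩
        d n + dst (vertex (suc n)) (vertex (suc n + r)) ≤⟨ +-monoʳ-≤ (d n) tail≤span ⟩
        span n (suc r)                                  ≤⟨ span≤dist n (suc r) r<k ⟩
        dst (vertex n) (vertex (n + suc r))             ∎
        where
        open ≤-Reasoning
        tail≤span : dst (vertex (suc n)) (vertex (suc n + r)) ≤ span (suc n) r
        tail≤span = dist≤word-shift (suc n) (suc n + r) (span (suc n) r)
                      (λ _ → ≤-trans 1≤r (r≤span (suc n) r))
                      (λ m → cong (λ x → word (x + m)) (sym (offset-+ (suc n) r)))

      successor-shortcut : ∀ {s t} → s ∈ v₀ ∷ vs → t ∈ v₀ ∷ vs → s ≢ t → (s , t) ∉ cycleEdges _≟_ (v₀ ∷ vs) →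
                           ∃[ v ] (v ∈ S × v ≢ s × v ≢ t × dst s v + dst v t ≤ dst s t)
      successor-shortcut s∈ t∈ s≢t st∉ with ∈⇒vertex s∈ | ∈⇒vertex t∈
      ... | i , i<k , refl | j , j<k , refl with forward i<k j<k
      ...   | zero , _ , i+0~j = ⊥-elim (s≢t (trans (cong vertex (sym (+-identityʳ i))) i+0~j))
      ...   | suc zero , _ , i+1~j =
        ⊥-elim (st∉ (subst (λ x → (vertex i , x) ∈ cycleEdges _≟_ (v₀ ∷ vs))
                      (trans (cong vertex (+-comm 1 i)) i+1~j) (edge-∈ i)))
      ...   | suc (suc r) , r<k , i+r~j = vertex (suc i) , vertex∈S (suc i) , v≢s , v≢t ,
        subst (λ x → d i + dst (vertex (suc i)) x ≤ dst (vertex i) x) i+r~j (detour i (suc (suc r)) (s≤s (s≤s z≤n)) r<k)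
        where
        v≢s : vertex (suc i) ≢ vertex i
        v≢s v~s = vertex-distinct cycle-unique (n<1+n i)
                    (subst (_< i + k) (+-comm i 1) (+-monoʳ-< i (≤-<-trans (s≤s z≤n) r<k))) (sym v~s)
        v≢t : vertex (suc i) ≢ vertex j
        v≢t v~t = vertex-distinct cycle-unique
                    (subst (_< i + suc (suc r)) (+-comm i 1) (+-monoʳ-< i (s≤s (s≤s z≤n))))
                    (subst (i + suc (suc r) <_) (+-suc i k) (+-monoʳ-< i (<-trans r<k (n<1+n k))))
                    (trans v~t (sym i+r~j))

    successor-shortcut : ∀ {s t} → s ∈ v₀ ∷ vs → t ∈ v₀ ∷ vs → s ≢ t → (s , t) ∉ cycleEdges _≟_ (v₀ ∷ vs) →
                         ∃[ v ] (v ∈ S × v ≢ s × v ≢ t × dst s v + dst v t ≤ dst s t)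
    successor-shortcut = ClosingEdge.successor-shortcut (proj₁ closing) (proj₂ closing)

mainTheorem7 : {A : Set} (_≟_ : DecidableEquality A)
    (S : List (Str A)) → Unique S → SubstringFree _≟_ S →
    (L : List (Edge A)) → SortedPairs _≟_ S L →
    (c : List (Str A)) → IsCycleOf _≟_ (mgreedy _≟_ L) c →
    2 * weight _≟_ c < closingOv _≟_ (mgreedy _≟_ L) c →
    (s t : Str A) → s ∈ c → t ∈ c → ¬ ((s , t) ∈ cycleEdges _≟_ c) →
    ∃[ u ] ((u ↭ S) × IsShortestSuperstring _≟_ S (mergeAll _≟_ u) × ¬ Merged _≟_ s t u)
mainTheorem7 _≟_ S _ _ L _ [] is-cycle _ s t _ _ _ = ⊥-elim (proj₁ is-cycle refl)
mainTheorem7 _≟_ S S-unique S-free L L-sorted (v₀ ∷ vs) is-cycle small s t s∈ t∈ st∉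
  with optimalOrdering _≟_ S
... | u , u-optimal with merged? _≟_ s t u
...   | no ¬merged = u , proj₁ u-optimal , optimal⇒shortest _≟_ S-unique S-free u-optimal , ¬merged
...   | yes merged
  with SmallCycle.successor-shortcut _≟_ S S-free L L-sorted v₀ vs is-cycle small s∈ t∈
         (Merged⇒≢ _≟_ (Unique-resp-↭ (↭-sym (proj₁ u-optimal)) S-unique) merged) st∉
...     | v , v∈S , v≢s , v≢t , detour with insert-between _≟_ S-unique u-optimal merged v∈S v≢s v≢t detour
...       | u′ , u′-optimal , ¬merged′ =
  u′ , proj₁ u′-optimal , optimal⇒shortest _≟_ S-unique S-free u′-optimal , ¬merged′
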